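{- Let $M$ be a simple binary matroid of rank $r+1$. Then (the simplification of) $M/e$ is isomorphic to $PG(r-1,2)$ for all $e\in E(M)$ if and only if $M$ is isomorphic to $P_{r+1}\backslash P_{r-i}$ for some $i\in\{0,1,\dots,r\}$.
   Context: Every contraction is immediately followed by simplification. $P_k$ denotes the binary projective geometry $PG(k-1,2)$. $P_{r+1}\backslash P_{r-i}$ denotes the matroid obtained from $P_{r+1}$ by deleting the elements of a rank-$(r-i)$ flat (independent of the choice of flat; a rank-$0$ flat is empty). -}

module Defs where

open import Data.Nat using (ℕ; zero; suc; _+_; _∸_; _^_; _≤_; _<_; _%_; _/_; _≡ᵇ_)
open import Data.Bool using (Bool; true; false; _xor_; if_then_else_)
open import Data.Fin using (Fin; toℕ) renaming (zero to fzero; suc to fsuc)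
open import Data.Fin.Subset
  using (Subset; _∈_; _∉_; _⊆_; ∣_∣; ⁅_⁆; _∪_; Nonempty)
  renaming (⊥ to ∅)
open import Data.Vec using (Vec; []; _∷_; replicate; zipWith; lookup; tabulate)
open import Data.Product using (Σ; ∃; ∃-syntax; _×_; _,_)
open import Data.Sum using (_⊎_)
open import Function using (_∘_)
open import Function.Bundles using (_⇔_; _↔_; Inverse)
open import Relation.Binary.PropositionalEquality using (_≡_; _≢_)
open import Relation.Nullary using (¬_)

IndepPred : ℕ → Set₁
IndepPred n = Subset n → Set

record Matroid : Set₁ where
  field
    size      : ℕ
    Indep     : IndepPred size
    indep-∅   : Indep ∅
    indep-⊆   : ∀ {X Y} → Y ⊆ X → Indep X → Indep Y
    indep-aug : ∀ {X Y} → Indep X → Indep Y → ∣ X ∣ < ∣ Y ∣ →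
                ∃[ y ] (y ∈ Y × y ∉ X × Indep (X ∪ ⁅ y ⁆))
open Matroid public

vzero : ∀ {k} → Vec Bool k
vzero = replicate _ false

vadd : ∀ {k} → Vec Bool k → Vec Bool k → Vec Bool k
vadd = zipWith _xor_

subsetSum : ∀ {n k} → (Fin n → Vec Bool k) → Subset n → Vec Bool k
subsetSum {zero}  φ []      = vzero
subsetSum {suc n} φ (b ∷ Y) =
  if b then vadd (φ fzero) (subsetSum (φ ∘ fsuc) Y)
       else subsetSum (φ ∘ fsuc) Y

-- The family (φ x)_{x ∈ X} is linearly independent over GF(2):
-- no nontrivial GF(2)-linear combination (= nonempty subfamily sum) vanishes.
LinIndep : ∀ {n k} → (Fin n → Vec Bool k) → IndepPred n
LinIndep φ X = ∀ Y → Y ⊆ X → Nonempty Y → subsetSum φ Y ≢ vzero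

IsBinary : Matroid → Set
IsBinary M = ∃[ k ] Σ (Fin (size M) → Vec Bool k) λ φ →
  ∀ X → Indep M X ⇔ LinIndep φ X

IsSimple : Matroid → Set
IsSimple M = (∀ x → Indep M ⁅ x ⁆) ×
             (∀ x y → x ≢ y → Indep M (⁅ x ⁆ ∪ ⁅ y ⁆))

HasRank : Matroid → ℕ → Set
HasRank M r = (∃[ X ] (Indep M X × ∣ X ∣ ≡ r)) ×
              (∀ X → Indep M X → ∣ X ∣ ≤ r)

-- We keep e in the ground
-- set as a loop of M/e; it is removed by the subsequent simplification.

contract : ∀ {n} → IndepPred n → Fin n → IndepPred n
contract I e X = e ∉ X × I (X ∪ ⁅ e ⁆)

Loop : ∀ {n} → IndepPred n → Fin n → Set
Loop I x = ¬ I ⁅ x ⁆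

Parallel : ∀ {n} → IndepPred n → Fin n → Fin n → Set
Parallel I x y = ¬ Loop I x × ¬ Loop I y × (x ≡ y ⊎ ¬ I (⁅ x ⁆ ∪ ⁅ y ⁆))

-- The simplification of I is isomorphic to P:
-- f picks exactly one non-loop element from each parallel class of I,
-- and f is an isomorphism from P onto the restriction of I to these
-- representatives.
SiIso : ∀ {n m} → IndepPred n → IndepPred m → Set
SiIso {n} {m} I P = Σ (Fin m → Fin n) λ f →
  (∀ j → ¬ Loop I (f j)) ×
  (∀ j j' → Parallel I (f j) (f j') → j ≡ j') ×
  (∀ x → ¬ Loop I x → ∃[ j ] Parallel I x (f j)) ×
  (∀ (Y : Subset m) (X : Subset n) →
     (∀ x → (x ∈ X) ⇔ (∃[ j ] (j ∈ Y × f j ≡ x))) →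
     P Y ⇔ I X)

_≅_ : ∀ {n m} → IndepPred n → IndepPred m → Set
_≅_ {n} {m} I P = Σ (Fin n ↔ Fin m) λ σ →
  ∀ (X : Subset n) → I X ⇔ P (tabulate (λ j → lookup X (Inverse.from σ j)))

toBits : (k : ℕ) → ℕ → Vec Bool k
toBits zero    n = []
toBits (suc k) n = (n % 2 ≡ᵇ 1) ∷ toBits k (n / 2)

-- P_k \ P_m  (m ≤ k): the nonzero vectors of GF(2)^k outside the rank-m
-- flat spanned by the first m unit vectors, i.e. the vectors with binary
-- value in [2^m, 2^k), enumerated as j ↦ toBits k (j + 2^m).
pgDelVec : (k m : ℕ) → Fin (2 ^ k ∸ 2 ^ m) → Vec Bool k
pgDelVec k m j = toBits k (toℕ j + 2 ^ m)

PGdel : (k m : ℕ) → IndepPred (2 ^ k ∸ 2 ^ m)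
PGdel k m = LinIndep (pgDelVec k m)

-- P_k = PG(k-1,2): all nonzero vectors of GF(2)^k (delete the empty rank-0 flat)
PG : (k : ℕ) → IndepPred (2 ^ k ∸ 2 ^ 0)
PG k = PGdel k 0

{-# OPTIONS --safe #-}
-- Coordinatise M by distinct nonzero vectors c x spanning GF(2)^(r+1); contracting e is projecting
-- along c e onto GF(2)^r. Then si(M/e) ≅ PG(r-1,2) iff every line {v, v + c e} through c e contains
-- a second point of M. For "only if", the projected representatives of the parallel classes of M/e
-- carry the matroid of PG(r-1,2), so together with 0 they are closed under sums; as they contain the
-- projection of every point, and the points span, they exhaust GF(2)^r.
-- If every line through every point meets a second point, the non-points are closed under sums
-- (were u + v = c x with u, v non-points, the line through c x and u would contain v), i.e. they
-- form a flat F. A change of coordinates moves F to the span of the first m unit vectors, which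
-- exhibits M as P_(r+1) minus a rank-m flat, m ≤ r as M is nonempty. Conversely the points of
-- P_(r+1) \ P_m are the complement of a flat, so every line through a point meets another one.
module Submission where

open import Defs
open import Data.Nat using (ℕ; zero; suc; _+_; _*_; _∸_; _^_; _≤_; _<_; z≤n; s≤s; _%_; _/_; _≡ᵇ_)
import Data.Nat.Properties as ℕP
open import Data.Nat.DivMod using (m≡m%n+[m/n]*n; [m+kn]%n≡m%n; m%n<n; +-distrib-/; m*n%n≡0; m*n/n≡m; m<n*o⇒m/o<n)
open import Data.Bool using (Bool; true; false; _xor_; not)
import Data.Bool.Properties as BP
open import Data.Fin using (Fin; toℕ; fromℕ<) renaming (zero to fzero; suc to fsuc)
import Data.Fin.Properties as FP
open import Data.Fin.Subset using (Subset; _∈_; _∉_; _⊆_; _⊂_; ∣_∣; ⁅_⁆; _∪_; Nonempty; Empty) renaming (⊥ to ∅)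
import Data.Fin.Subset as Sub
import Data.Fin.Subset.Properties as SP
open import Data.Vec using (Vec; []; _∷_; lookup; tabulate; insertAt; removeAt; _[_]≔_; here; there)
import Data.Vec.Properties as VP
open import Data.Product using (Σ; ∃-syntax; _×_; _,_; proj₁; proj₂)
open import Data.Empty using (⊥)
open import Data.Sum using (_⊎_; inj₁; inj₂)
import Data.Sum
open import Data.Unit using (⊤; tt)
open import Function using (_∘_; id; case_of_)
open import Function.Bundles using (_⇔_; _↔_; Inverse; Injection; mk⇔; mk↔ₛ′; Equivalence)
open import Function.Definitions using (Injective)
import Function.Properties.Equivalence as ⇔
open import Function.Properties.Inverse using (Inverse⇒Injection)
open import Relation.Binary.PropositionalEquality
open import Relation.Nullary using (¬_; Dec; yes; no; does; contradiction)
open import Relation.Nullary.Decidable using (_×-dec_; ¬?; dec-true; toWitness; isYes≗does)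

open Equivalence using (to; from)
open ≡-Reasoning

-- Vectors and subset sums over GF(2)

V : ℕ → Set
V = Vec Bool

infixl 6 _⊕_
infixr 7 _·_

_⊕_ : ∀ {k} → V k → V k → V k
_⊕_ = vadd

_·_ : ∀ {k} → Bool → V k → V k
true  · v = v
false · v = vzero

⊕-comm : ∀ {k} (u v : V k) → u ⊕ v ≡ v ⊕ u
⊕-comm = VP.zipWith-comm BP.xor-comm

⊕-assoc : ∀ {k} (u v w : V k) → u ⊕ v ⊕ w ≡ u ⊕ (v ⊕ w)
⊕-assoc = VP.zipWith-assoc BP.xor-assoc

⊕-identityˡ : ∀ {k} (v : V k) → vzero ⊕ v ≡ v
⊕-identityˡ = VP.zipWith-identityˡ BP.xor-identityˡ

⊕-identityʳ : ∀ {k} (v : V k) → v ⊕ vzero ≡ v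
⊕-identityʳ = VP.zipWith-identityʳ BP.xor-identityʳ

⊕-self : ∀ {k} (v : V k) → v ⊕ v ≡ vzero
⊕-self []      = refl
⊕-self (b ∷ v) = cong₂ _∷_ (BP.xor-same b) (⊕-self v)

⊕-cancelˡ : ∀ {k} (u v : V k) → u ⊕ (u ⊕ v) ≡ v
⊕-cancelˡ u v = begin
  u ⊕ (u ⊕ v) ≡⟨ ⊕-assoc u u v ⟨
  u ⊕ u ⊕ v   ≡⟨ cong (_⊕ v) (⊕-self u) ⟩
  vzero ⊕ v   ≡⟨ ⊕-identityˡ v ⟩
  v           ∎

⊕-cancelʳ : ∀ {k} (u v : V k) → u ⊕ v ⊕ v ≡ u
⊕-cancelʳ u v = begin
  u ⊕ v ⊕ v   ≡⟨ ⊕-assoc u v v ⟩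
  u ⊕ (v ⊕ v) ≡⟨ cong (u ⊕_) (⊕-self v) ⟩
  u ⊕ vzero   ≡⟨ ⊕-identityʳ u ⟩
  u           ∎

⊕≡vzero⇒≡ : ∀ {k} {u v : V k} → u ⊕ v ≡ vzero → u ≡ v
⊕≡vzero⇒≡ {u = u} {v} eq = begin
  u         ≡⟨ ⊕-cancelʳ u v ⟨
  u ⊕ v ⊕ v ≡⟨ cong (_⊕ v) eq ⟩
  vzero ⊕ v ≡⟨ ⊕-identityˡ v ⟩
  v         ∎

⊕≡ˡ⇒≡vzero : ∀ {k} {u v : V k} → u ⊕ v ≡ u → v ≡ vzero
⊕≡ˡ⇒≡vzero {u = u} {v} eq = trans (sym (⊕-cancelˡ u v)) (trans (cong (u ⊕_) eq) (⊕-self u))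

⊕≡ʳ⇒≡vzero : ∀ {k} {u v : V k} → u ⊕ v ≡ v → u ≡ vzero
⊕≡ʳ⇒≡vzero {u = u} {v} eq = ⊕≡ˡ⇒≡vzero (trans (⊕-comm v u) eq)

⊕-interchange : ∀ {k} (a b c d : V k) → a ⊕ b ⊕ (c ⊕ d) ≡ a ⊕ c ⊕ (b ⊕ d)
⊕-interchange a b c d = begin
  a ⊕ b ⊕ (c ⊕ d)   ≡⟨ ⊕-assoc a b (c ⊕ d) ⟩
  a ⊕ (b ⊕ (c ⊕ d)) ≡⟨ cong (a ⊕_) (⊕-assoc b c d) ⟨
  a ⊕ (b ⊕ c ⊕ d)   ≡⟨ cong (λ x → a ⊕ (x ⊕ d)) (⊕-comm b c) ⟩
  a ⊕ (c ⊕ b ⊕ d)   ≡⟨ cong (a ⊕_) (⊕-assoc c b d) ⟩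
  a ⊕ (c ⊕ (b ⊕ d)) ≡⟨ ⊕-assoc a c (b ⊕ d) ⟨
  a ⊕ c ⊕ (b ⊕ d)   ∎

⊕-leftComm : ∀ {k} (a b c : V k) → a ⊕ (b ⊕ c) ≡ b ⊕ (a ⊕ c)
⊕-leftComm a b c = begin
  a ⊕ (b ⊕ c) ≡⟨ ⊕-assoc a b c ⟨
  a ⊕ b ⊕ c   ≡⟨ cong (_⊕ c) (⊕-comm a b) ⟩
  b ⊕ a ⊕ c   ≡⟨ ⊕-assoc b a c ⟩
  b ⊕ (a ⊕ c) ∎

·-distribʳ-xor : ∀ {k} a b (v : V k) → (a xor b) · v ≡ a · v ⊕ b · v
·-distribʳ-xor true  true  v = sym (⊕-self v)
·-distribʳ-xor true  false v = sym (⊕-identityʳ v)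
·-distribʳ-xor false b     v = sym (⊕-identityˡ (b · v))

·-vzero : ∀ {k} b → b · vzero {k} ≡ vzero
·-vzero true  = refl
·-vzero false = refl

_≟V_ : ∀ {k} (u v : V k) → Dec (u ≡ v)
_≟V_ = VP.≡-dec BP._≟_

lookup-⊕ : ∀ {k} (u v : V k) i → lookup (u ⊕ v) i ≡ lookup u i xor lookup v i
lookup-⊕ u v i = VP.lookup-zipWith _xor_ i u v

lookup-vzero : ∀ {k} (i : Fin k) → lookup (vzero {k}) i ≡ false
lookup-vzero i = VP.lookup-replicate i false

allFalse⇒≡vzero : ∀ {k} (v : V k) → (∀ i → lookup v i ≡ false) → v ≡ vzero
allFalse⇒≡vzero []      _ = refl
allFalse⇒≡vzero (b ∷ v) h = cong₂ _∷_ (h fzero) (allFalse⇒≡vzero v (h ∘ fsuc))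

≢vzero⇒∃true : ∀ {k} (v : V k) → v ≢ vzero → ∃[ i ] lookup v i ≡ true
≢vzero⇒∃true v v≢0 with FP.any? (λ i → lookup v i BP.≟ true)
... | yes p = p
... | no ¬p = contradiction (allFalse⇒≡vzero v (λ i → BP.¬-not (λ t → ¬p (i , t)))) v≢0

Linear : ∀ {k l} → (V k → V l) → Set
Linear A = ∀ u v → A (u ⊕ v) ≡ A u ⊕ A v

linear-vzero : ∀ {k l} {A : V k → V l} → Linear A → A vzero ≡ vzero
linear-vzero {A = A} lin = begin
  A vzero             ≡⟨ cong A (⊕-self vzero) ⟨
  A (vzero ⊕ vzero)   ≡⟨ lin vzero vzero ⟩
  A vzero ⊕ A vzero   ≡⟨ ⊕-self (A vzero) ⟩
  vzero               ∎

Closed⊕ : ∀ {K} → (V K → Set) → Set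
Closed⊕ F = ∀ {u v} → F u → F v → F (u ⊕ v)

linear-· : ∀ {k l} {A : V k → V l} → Linear A → ∀ b v → A (b · v) ≡ b · A v
linear-· lin true  v = refl
linear-· lin false v = linear-vzero lin

∈⇒lookup : ∀ {n} {x : Fin n} {Z : Subset n} → x ∈ Z → lookup Z x ≡ true
∈⇒lookup = VP.[]=⇒lookup

lookup⇒∈ : ∀ {n} {x : Fin n} {Z : Subset n} → lookup Z x ≡ true → x ∈ Z
lookup⇒∈ {x = x} {Z} = VP.lookup⇒[]= x Z

∉⇒lookup : ∀ {n} {x : Fin n} {Z : Subset n} → x ∉ Z → lookup Z x ≡ false
∉⇒lookup x∉Z = BP.¬-not (x∉Z ∘ lookup⇒∈)

∉-[]≔false : ∀ {n} (Z : Subset n) x → x ∉ Z [ x ]≔ false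
∉-[]≔false Z x x∈ = contradiction (trans (sym (VP.lookup∘update x Z false)) (∈⇒lookup x∈)) λ ()

∈-[]≔false⁻ : ∀ {n} {Z : Subset n} {x y} → y ∈ Z [ x ]≔ false → y ∈ Z × y ≢ x
∈-[]≔false⁻ {Z = Z} {x} {y} y∈ with y FP.≟ x
... | yes refl = contradiction y∈ (∉-[]≔false Z x)
... | no y≢x = lookup⇒∈ (trans (sym (VP.lookup∘update′ y≢x Z false)) (∈⇒lookup y∈)) , y≢x

∈-[]≔false⁺ : ∀ {n} {Z : Subset n} {x y} → y ∈ Z → y ≢ x → y ∈ Z [ x ]≔ false
∈-[]≔false⁺ {Z = Z} y∈Z y≢x = lookup⇒∈ (trans (VP.lookup∘update′ y≢x Z false) (∈⇒lookup y∈Z))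

∈-[]≔true⁻ : ∀ {n} {Z : Subset n} {x y} → y ∈ Z [ x ]≔ true → y ≡ x ⊎ y ∈ Z
∈-[]≔true⁻ {Z = Z} {x} {y} y∈ with y FP.≟ x
... | yes y≡x = inj₁ y≡x
... | no y≢x = inj₂ (lookup⇒∈ (trans (sym (VP.lookup∘update′ y≢x Z true)) (∈⇒lookup y∈)))

[]≔false-⊆ : ∀ {n} {Z W : Subset n} {a} → (∀ {y} → y ∈ Z → y ≢ a → y ∈ W) →
  Z [ a ]≔ false ⊆ W
[]≔false-⊆ Z∖a⊆W y∈ = let y∈Z , y≢a = ∈-[]≔false⁻ y∈ in Z∖a⊆W y∈Z y≢a

∈⁅⁆∪-drop : ∀ {n} {W : Subset n} {a y} → y ∈ ⁅ a ⁆ ∪ W → y ≢ a → y ∈ W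
∈⁅⁆∪-drop {W = W} {a} y∈ y≢a with SP.x∈p∪q⁻ ⁅ a ⁆ W y∈
... | inj₁ y∈⁅a⁆ = contradiction (SP.x∈⁅y⁆⇒x≡y a y∈⁅a⁆) y≢a
... | inj₂ y∈W   = y∈W

∈∪⁅⁆-drop : ∀ {n} {W : Subset n} {a y} → y ∈ W ∪ ⁅ a ⁆ → y ≢ a → y ∈ W
∈∪⁅⁆-drop {W = W} {a} y∈ y≢a with SP.x∈p∪q⁻ W ⁅ a ⁆ y∈
... | inj₁ y∈W   = y∈W
... | inj₂ y∈⁅a⁆ = contradiction (SP.x∈⁅y⁆⇒x≡y a y∈⁅a⁆) y≢a

∈⇒· : ∀ {n k} {x : Fin n} {Z : Subset n} (v : V k) → x ∈ Z → lookup Z x · v ≡ v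
∈⇒· v x∈Z = cong (_· v) (∈⇒lookup x∈Z)

subsetSum-∷ : ∀ {n k} (φ : Fin (suc n) → V k) b Y →
  subsetSum φ (b ∷ Y) ≡ b · φ fzero ⊕ subsetSum (φ ∘ fsuc) Y
subsetSum-∷ φ true  Y = refl
subsetSum-∷ φ false Y = sym (⊕-identityˡ _)

subsetSum-∅ : ∀ {n k} (φ : Fin n → V k) → subsetSum φ ∅ ≡ vzero
subsetSum-∅ {zero}  φ = refl
subsetSum-∅ {suc n} φ = subsetSum-∅ (φ ∘ fsuc)

subsetSum-empty : ∀ {n k} (φ : Fin n → V k) {Z} → Empty Z → subsetSum φ Z ≡ vzero
subsetSum-empty φ Z-empty = trans (cong (subsetSum φ) (SP.Empty-unique Z-empty)) (subsetSum-∅ φ)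

subsetSum-linear : ∀ {n k} (φ : Fin n → V k) → Linear (subsetSum φ)
subsetSum-linear φ []      []      = sym (⊕-self vzero)
subsetSum-linear φ (a ∷ Y) (b ∷ Z) = begin
  subsetSum φ ((a xor b) ∷ (Y ⊕ Z))
    ≡⟨ subsetSum-∷ φ (a xor b) (Y ⊕ Z) ⟩
  (a xor b) · φ fzero ⊕ subsetSum (φ ∘ fsuc) (Y ⊕ Z)
    ≡⟨ cong₂ _⊕_ (·-distribʳ-xor a b (φ fzero)) (subsetSum-linear (φ ∘ fsuc) Y Z) ⟩
  a · φ fzero ⊕ b · φ fzero ⊕ (subsetSum (φ ∘ fsuc) Y ⊕ subsetSum (φ ∘ fsuc) Z)
    ≡⟨ ⊕-interchange _ _ _ _ ⟩
  a · φ fzero ⊕ subsetSum (φ ∘ fsuc) Y ⊕ (b · φ fzero ⊕ subsetSum (φ ∘ fsuc) Z)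
    ≡⟨ cong₂ _⊕_ (subsetSum-∷ φ a Y) (subsetSum-∷ φ b Z) ⟨
  subsetSum φ (a ∷ Y) ⊕ subsetSum φ (b ∷ Z) ∎

subsetSum-map : ∀ {n k l} {A : V k → V l} → Linear A → (φ : Fin n → V k) (Z : Subset n) →
  subsetSum (A ∘ φ) Z ≡ A (subsetSum φ Z)
subsetSum-map lin φ []      = sym (linear-vzero lin)
subsetSum-map {A = A} lin φ (b ∷ Z) = begin
  subsetSum (A ∘ φ) (b ∷ Z)
    ≡⟨ subsetSum-∷ (A ∘ φ) b Z ⟩
  b · A (φ fzero) ⊕ subsetSum (A ∘ φ ∘ fsuc) Z
    ≡⟨ cong₂ _⊕_ (linear-· lin b (φ fzero)) (sym (subsetSum-map lin (φ ∘ fsuc) Z)) ⟨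
  A (b · φ fzero) ⊕ A (subsetSum (φ ∘ fsuc) Z)
    ≡⟨ lin _ _ ⟨
  A (b · φ fzero ⊕ subsetSum (φ ∘ fsuc) Z)
    ≡⟨ cong A (subsetSum-∷ φ b Z) ⟨
  A (subsetSum φ (b ∷ Z)) ∎

subsetSum-cong : ∀ {n k} {φ ψ : Fin n → V k} → (∀ x → φ x ≡ ψ x) → ∀ Z →
  subsetSum φ Z ≡ subsetSum ψ Z
subsetSum-cong φ≗ψ []      = refl
subsetSum-cong {φ = φ} {ψ} φ≗ψ (b ∷ Z) = begin
  subsetSum φ (b ∷ Z)                     ≡⟨ subsetSum-∷ φ b Z ⟩
  b · φ fzero ⊕ subsetSum (φ ∘ fsuc) Z
    ≡⟨ cong₂ (λ v w → b · v ⊕ w) (φ≗ψ fzero) (subsetSum-cong (φ≗ψ ∘ fsuc) Z) ⟩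
  b · ψ fzero ⊕ subsetSum (ψ ∘ fsuc) Z    ≡⟨ subsetSum-∷ ψ b Z ⟨
  subsetSum ψ (b ∷ Z)                     ∎

subsetSum-split : ∀ {n k} (φ : Fin n → V k) (Z : Subset n) x →
  subsetSum φ Z ≡ lookup Z x · φ x ⊕ subsetSum φ (Z [ x ]≔ false)
subsetSum-split φ (b ∷ Z) fzero    = subsetSum-∷ φ b Z
subsetSum-split φ (b ∷ Z) (fsuc x) = begin
  subsetSum φ (b ∷ Z)
    ≡⟨ subsetSum-∷ φ b Z ⟩
  b · φ fzero ⊕ subsetSum (φ ∘ fsuc) Z
    ≡⟨ cong (b · φ fzero ⊕_) (subsetSum-split (φ ∘ fsuc) Z x) ⟩
  b · φ fzero ⊕ (lookup Z x · φ (fsuc x) ⊕ subsetSum (φ ∘ fsuc) (Z [ x ]≔ false))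
    ≡⟨ ⊕-leftComm _ _ _ ⟩
  lookup Z x · φ (fsuc x) ⊕ (b · φ fzero ⊕ subsetSum (φ ∘ fsuc) (Z [ x ]≔ false))
    ≡⟨ cong (lookup Z x · φ (fsuc x) ⊕_) (subsetSum-∷ φ b (Z [ x ]≔ false)) ⟨
  lookup Z x · φ (fsuc x) ⊕ subsetSum φ (b ∷ Z [ x ]≔ false) ∎

subsetSum-[]≔true : ∀ {n k} (φ : Fin n → V k) {Z : Subset n} {x} → x ∉ Z →
  subsetSum φ (Z [ x ]≔ true) ≡ φ x ⊕ subsetSum φ Z
subsetSum-[]≔true φ {Z} {x} x∉Z = begin
  subsetSum φ (Z [ x ]≔ true)
    ≡⟨ subsetSum-split φ (Z [ x ]≔ true) x ⟩
  lookup (Z [ x ]≔ true) x · φ x ⊕ subsetSum φ (Z [ x ]≔ true [ x ]≔ false)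
    ≡⟨ cong₂ (λ b W → b · φ x ⊕ subsetSum φ W) (VP.lookup∘update x Z true) (VP.[]≔-idempotent Z x) ⟩
  φ x ⊕ subsetSum φ (Z [ x ]≔ false)
    ≡⟨ cong (λ b → φ x ⊕ subsetSum φ (Z [ x ]≔ b)) (∉⇒lookup x∉Z) ⟨
  φ x ⊕ subsetSum φ (Z [ x ]≔ lookup Z x)
    ≡⟨ cong (λ W → φ x ⊕ subsetSum φ W) (VP.[]≔-lookup Z x) ⟩
  φ x ⊕ subsetSum φ Z ∎

subsetSum-⊆⁅⁆ : ∀ {n k} (φ : Fin n → V k) {Z : Subset n} a → Z ⊆ ⁅ a ⁆ →
  subsetSum φ Z ≡ lookup Z a · φ a
subsetSum-⊆⁅⁆ φ {Z} a Z⊆ = begin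
  subsetSum φ Z                                   ≡⟨ subsetSum-split φ Z a ⟩
  lookup Z a · φ a ⊕ subsetSum φ (Z [ a ]≔ false)
    ≡⟨ cong (lookup Z a · φ a ⊕_) (subsetSum-empty φ rest-empty) ⟩
  lookup Z a · φ a ⊕ vzero                        ≡⟨ ⊕-identityʳ _ ⟩
  lookup Z a · φ a                                ∎
  where
  rest-empty : Empty (Z [ a ]≔ false)
  rest-empty (y , y∈) = let y∈Z , y≢a = ∈-[]≔false⁻ y∈ in y≢a (SP.x∈⁅y⁆⇒x≡y a (Z⊆ y∈Z))

subsetSum-⊆pair : ∀ {n k} (φ : Fin n → V k) {Z : Subset n} a b → a ≢ b → Z ⊆ ⁅ a ⁆ ∪ ⁅ b ⁆ →
  subsetSum φ Z ≡ lookup Z a · φ a ⊕ lookup Z b · φ b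
subsetSum-⊆pair φ {Z} a b a≢b Z⊆ = begin
  subsetSum φ Z
    ≡⟨ subsetSum-split φ Z a ⟩
  lookup Z a · φ a ⊕ subsetSum φ (Z [ a ]≔ false)
    ≡⟨ cong (lookup Z a · φ a ⊕_) (subsetSum-⊆⁅⁆ φ b ([]≔false-⊆ (∈⁅⁆∪-drop ∘ Z⊆))) ⟩
  lookup Z a · φ a ⊕ lookup (Z [ a ]≔ false) b · φ b
    ≡⟨ cong (λ t → lookup Z a · φ a ⊕ t · φ b) (VP.lookup∘update′ (a≢b ∘ sym) Z false) ⟩
  lookup Z a · φ a ⊕ lookup Z b · φ b ∎

subsetSum-⊆triple : ∀ {n k} (φ : Fin n → V k) {Z : Subset n} a b c → a ≢ b → a ≢ c → b ≢ c →
  Z ⊆ ⁅ a ⁆ ∪ ⁅ b ⁆ ∪ ⁅ c ⁆ →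
  subsetSum φ Z ≡ lookup Z a · φ a ⊕ (lookup Z b · φ b ⊕ lookup Z c · φ c)
subsetSum-⊆triple φ {Z} a b c a≢b a≢c b≢c Z⊆ = begin
  subsetSum φ Z
    ≡⟨ subsetSum-split φ Z a ⟩
  lookup Z a · φ a ⊕ subsetSum φ (Z [ a ]≔ false)
    ≡⟨ cong (lookup Z a · φ a ⊕_) (subsetSum-⊆pair φ b c b≢c ([]≔false-⊆ (∈⁅⁆∪-drop ∘ Z⊆))) ⟩
  lookup Z a · φ a ⊕ (lookup (Z [ a ]≔ false) b · φ b ⊕ lookup (Z [ a ]≔ false) c · φ c)
    ≡⟨ cong₂ (λ s t → lookup Z a · φ a ⊕ (s · φ b ⊕ t · φ c))
             (VP.lookup∘update′ (a≢b ∘ sym) Z false) (VP.lookup∘update′ (a≢c ∘ sym) Z false) ⟩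
  lookup Z a · φ a ⊕ (lookup Z b · φ b ⊕ lookup Z c · φ c) ∎

subsetSum-⁅⁆ : ∀ {n k} (φ : Fin n → V k) x → subsetSum φ ⁅ x ⁆ ≡ φ x
subsetSum-⁅⁆ φ x = trans (subsetSum-⊆⁅⁆ φ x (λ {_} h → h)) (∈⇒· (φ x) (SP.x∈⁅x⁆ x))

subsetSum-closed : ∀ {n k} (P : V k → Set) → P vzero → Closed⊕ P →
  (φ : Fin n → V k) → (∀ x → P (φ x)) → ∀ Z → P (subsetSum φ Z)
subsetSum-closed P P0 P⊕ φ Pφ []          = P0
subsetSum-closed P P0 P⊕ φ Pφ (true ∷ Z)  =
  P⊕ (Pφ fzero) (subsetSum-closed P P0 P⊕ (φ ∘ fsuc) (Pφ ∘ fsuc) Z)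
subsetSum-closed P P0 P⊕ φ Pφ (false ∷ Z) = subsetSum-closed P P0 P⊕ (φ ∘ fsuc) (Pφ ∘ fsuc) Z

-- ⁅ t ⁆, read as a vector, is the t-th unit vector.
subsetSum-unitVectors : ∀ {k} (v : V k) → subsetSum ⁅_⁆ v ≡ v
subsetSum-unitVectors []      = refl
subsetSum-unitVectors (b ∷ v) = begin
  subsetSum ⁅_⁆ (b ∷ v)
    ≡⟨ subsetSum-∷ ⁅_⁆ b v ⟩
  b · (true ∷ vzero) ⊕ subsetSum (λ t → false ∷ ⁅ t ⁆) v
    ≡⟨ cong (b · (true ∷ vzero) ⊕_) (subsetSum-map {A = false ∷_} (λ _ _ → refl) ⁅_⁆ v) ⟩
  b · (true ∷ vzero) ⊕ (false ∷ subsetSum ⁅_⁆ v)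
    ≡⟨ cong (λ w → b · (true ∷ vzero) ⊕ (false ∷ w)) (subsetSum-unitVectors v) ⟩
  b · (true ∷ vzero) ⊕ (false ∷ v)
    ≡⟨ head b ⟩
  b ∷ v ∎
  where
  head : ∀ b → b · (true ∷ vzero) ⊕ (false ∷ v) ≡ b ∷ v
  head true  = cong (true ∷_) (⊕-identityˡ v)
  head false = cong (false ∷_) (⊕-identityˡ v)

IsImage : ∀ {m n} → (Fin m → Fin n) → Subset m → Subset n → Set
IsImage f Y X = ∀ x → x ∈ X ⇔ (∃[ j ] (j ∈ Y × f j ≡ x))

hit? : ∀ {m n} (f : Fin m → Fin n) Y x → Dec (∃[ j ] (j ∈ Y × f j ≡ x))
hit? f Y x = FP.any? (λ j → (j SP.∈? Y) ×-dec (f j FP.≟ x))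

image : ∀ {m n} → (Fin m → Fin n) → Subset m → Subset n
image f Y = tabulate (does ∘ hit? f Y)

image-isImage : ∀ {m n} (f : Fin m → Fin n) Y → IsImage f Y (image f Y)
image-isImage f Y x = mk⇔
  (λ x∈ → toWitness {a? = hit? f Y x}
            (from BP.T-≡ (trans (isYes≗does (hit? f Y x))
                                (trans (sym (VP.lookup∘tabulate _ x)) (∈⇒lookup x∈)))))
  (λ hit → lookup⇒∈ (trans (VP.lookup∘tabulate _ x) (dec-true (hit? f Y x) hit)))

preimage : ∀ {m n} → (Fin m → Fin n) → Subset n → Subset m
preimage f X = tabulate (lookup X ∘ f)

∈-preimage : ∀ {m n} {f : Fin m → Fin n} {X j} → j ∈ preimage f X ⇔ f j ∈ X
∈-preimage {f = f} {X} {j} = mk⇔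
  (λ j∈ → lookup⇒∈ (trans (sym (VP.lookup∘tabulate (lookup X ∘ f) j)) (∈⇒lookup j∈)))
  (λ fj∈ → lookup⇒∈ (trans (VP.lookup∘tabulate (lookup X ∘ f) j) (∈⇒lookup fj∈)))

preimage-isImage : ∀ {m n} {f : Fin m → Fin n} {X} → (∀ {x} → x ∈ X → ∃[ j ] f j ≡ x) →
  IsImage f (preimage f X) X
preimage-isImage {f = f} {X} onto x = mk⇔
  (λ x∈X → let j , fj≡x = onto x∈X in j , from ∈-preimage (subst (_∈ X) (sym fj≡x) x∈X) , fj≡x)
  (λ { (j , j∈ , refl) → to ∈-preimage j∈ })

isImage-head : ∀ {m n} {f : Fin (suc m) → Fin n} {b Y X} → Injective _≡_ _≡_ f →
  IsImage f (b ∷ Y) X → lookup X (f fzero) ≡ b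
isImage-head {b = true}  inj im = ∈⇒lookup (from (im _) (fzero , here , refl))
isImage-head {f = f} {false} {X = X} inj im = ∉⇒lookup f0∉X
  where
  f0∉X : f fzero ∉ X
  f0∉X f0∈X with to (im _) f0∈X
  ... | j , j∈ , fj≡f0 with inj fj≡f0 | j∈
  ...   | refl | ()

isImage-tail : ∀ {m n} {f : Fin (suc m) → Fin n} {b Y X} → Injective _≡_ _≡_ f →
  IsImage f (b ∷ Y) X → IsImage (f ∘ fsuc) Y (X [ f fzero ]≔ false)
isImage-tail {f = f} {b} {Y} {X} inj im x = mk⇔ to′ from′
  where
  to′ : x ∈ X [ f fzero ]≔ false → ∃[ j ] (j ∈ Y × f (fsuc j) ≡ x)
  to′ x∈ with ∈-[]≔false⁻ x∈
  ... | x∈X , x≢f0 with to (im x) x∈X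
  ...   | fzero  , _   , f0≡x = contradiction (sym f0≡x) x≢f0
  ...   | fsuc j , j∈  , fj≡x = j , SP.drop-there j∈ , fj≡x
  from′ : ∃[ j ] (j ∈ Y × f (fsuc j) ≡ x) → x ∈ X [ f fzero ]≔ false
  from′ (j , j∈Y , refl) =
    ∈-[]≔false⁺ (from (im _) (fsuc j , there j∈Y , refl)) (λ eq → case inj eq of λ ())

subsetSum-image : ∀ {m n k} (φ : Fin n → V k) {f : Fin m → Fin n} → Injective _≡_ _≡_ f →
  ∀ {Y X} → IsImage f Y X → subsetSum φ X ≡ subsetSum (φ ∘ f) Y
subsetSum-image φ inj {[]} {X} im = subsetSum-empty φ X-empty
  where
  X-empty : Empty X
  X-empty (x , x∈X) with to (im x) x∈X
  ... | () , _
subsetSum-image φ {f} inj {b ∷ Y} {X} im = begin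
  subsetSum φ X
    ≡⟨ subsetSum-split φ X (f fzero) ⟩
  lookup X (f fzero) · φ (f fzero) ⊕ subsetSum φ (X [ f fzero ]≔ false)
    ≡⟨ cong₂ (λ t w → t · φ (f fzero) ⊕ w) (isImage-head inj im)
             (subsetSum-image φ (FP.suc-injective ∘ inj) (isImage-tail inj im)) ⟩
  b · φ (f fzero) ⊕ subsetSum (φ ∘ f ∘ fsuc) Y
    ≡⟨ subsetSum-∷ (φ ∘ f) b Y ⟨
  subsetSum (φ ∘ f) (b ∷ Y) ∎

-- Linear independence

linIndep-cong : ∀ {n k} {φ ψ : Fin n → V k} → (∀ x → φ x ≡ ψ x) → ∀ X →
  LinIndep φ X ⇔ LinIndep ψ X
linIndep-cong φ≗ψ X = mk⇔
  (λ li Z Z⊆X Z≠∅ sum≡0 → li Z Z⊆X Z≠∅ (trans (subsetSum-cong φ≗ψ Z) sum≡0))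
  (λ li Z Z⊆X Z≠∅ sum≡0 → li Z Z⊆X Z≠∅ (trans (subsetSum-cong (sym ∘ φ≗ψ) Z) sum≡0))

linIndep-map : ∀ {n k l} {A : V k → V l} → Linear A → (∀ v → A v ≡ vzero → v ≡ vzero) →
  (φ : Fin n → V k) → ∀ X → LinIndep φ X ⇔ LinIndep (A ∘ φ) X
linIndep-map {A = A} lin ker φ X = mk⇔
  (λ li Z Z⊆X Z≠∅ sum≡0 → li Z Z⊆X Z≠∅ (ker _ (trans (sym (subsetSum-map lin φ Z)) sum≡0)))
  (λ li Z Z⊆X Z≠∅ sum≡0 →
    li Z Z⊆X Z≠∅ (trans (subsetSum-map lin φ Z) (trans (cong A sum≡0) (linear-vzero lin))))

linIndep-image : ∀ {m n k} (φ : Fin n → V k) {f : Fin m → Fin n} → Injective _≡_ _≡_ f →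
  ∀ {Y X} → IsImage f Y X → LinIndep (φ ∘ f) Y ⇔ LinIndep φ X
linIndep-image φ {f} inj {Y} {X} im = mk⇔ to′ from′
  where
  to′ : LinIndep (φ ∘ f) Y → LinIndep φ X
  to′ li Z Z⊆X (x , x∈Z) sum≡0 =
    let j , j∈Z′ , _ = to (imZ x) x∈Z
    in li (preimage f Z) Z′⊆Y (j , j∈Z′) (trans (sym (subsetSum-image φ inj imZ)) sum≡0)
    where
    imZ : IsImage f (preimage f Z) Z
    imZ = preimage-isImage λ x∈Z → let j , _ , fj≡x = to (im _) (Z⊆X x∈Z) in j , fj≡x
    Z′⊆Y : preimage f Z ⊆ Y
    Z′⊆Y {j} j∈Z′ with to (im (f j)) (Z⊆X (to ∈-preimage j∈Z′))
    ... | j′ , j′∈Y , fj′≡fj = subst (_∈ Y) (inj fj′≡fj) j′∈Y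
  from′ : LinIndep φ X → LinIndep (φ ∘ f) Y
  from′ li Z Z⊆Y (j , j∈Z) sum≡0 =
    li (image f Z) fZ⊆X (f j , from (image-isImage f Z (f j)) (j , j∈Z , refl))
       (trans (subsetSum-image φ inj (image-isImage f Z)) sum≡0)
    where
    fZ⊆X : image f Z ⊆ X
    fZ⊆X {x} x∈fZ = let i , i∈Z , fi≡x = to (image-isImage f Z x) x∈fZ
                    in from (im x) (i , Z⊆Y i∈Z , fi≡x)

Dependent : ∀ {n k} → (Fin n → V k) → Subset n → Set
Dependent φ X = ∃[ Z ] (Z ⊆ X × Nonempty Z × subsetSum φ Z ≡ vzero)

linIndep-or-dependent : ∀ {n k} (φ : Fin n → V k) X → LinIndep φ X ⊎ Dependent φ X
linIndep-or-dependent φ X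
  with SP.anySubset? (λ Z → (Z SP.⊆? X) ×-dec (SP.nonempty? Z ×-dec (subsetSum φ Z ≟V vzero)))
... | yes dep = inj₂ dep
... | no ¬dep = inj₁ (λ Z Z⊆X Z≠∅ sum≡0 → ¬dep (Z , Z⊆X , Z≠∅ , sum≡0))

combination₂≢vzero : ∀ {k} s t (a b : V k) → s ≡ true ⊎ t ≡ true →
  a ≢ vzero → b ≢ vzero → a ≢ b → s · a ⊕ t · b ≢ vzero
combination₂≢vzero true  true  a b _ _   _   a≢b eq = a≢b (⊕≡vzero⇒≡ eq)
combination₂≢vzero true  false a b _ a≢0 _   _   eq = a≢0 (trans (sym (⊕-identityʳ a)) eq)
combination₂≢vzero false true  a b _ _   b≢0 _   eq = b≢0 (trans (sym (⊕-identityˡ b)) eq)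
combination₂≢vzero false false a b (inj₁ ())
combination₂≢vzero false false a b (inj₂ ())

combination₃≢vzero : ∀ {k} s t u (a b c : V k) → s ≡ true ⊎ t ≡ true ⊎ u ≡ true →
  a ≢ vzero → b ≢ vzero → c ≢ vzero → a ≢ b → a ≢ c → b ≢ c → a ⊕ (b ⊕ c) ≢ vzero →
  s · a ⊕ (t · b ⊕ u · c) ≢ vzero
combination₃≢vzero false t u a b c (inj₁ ())
combination₃≢vzero false t u a b c (inj₂ t∨u) _ b≢0 c≢0 _ _ b≢c _ eq =
  combination₂≢vzero t u b c t∨u b≢0 c≢0 b≢c (trans (sym (⊕-identityˡ _)) eq)
combination₃≢vzero true true  true  a b c _ _ _ _ _ _ _ a+b+c≢0 eq = a+b+c≢0 eq
combination₃≢vzero true true  false a b c _ _ _ _ a≢b _ _ _ eq =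
  a≢b (⊕≡vzero⇒≡ (trans (cong (a ⊕_) (sym (⊕-identityʳ b))) eq))
combination₃≢vzero true false true  a b c _ _ _ _ _ a≢c _ _ eq =
  a≢c (⊕≡vzero⇒≡ (trans (cong (a ⊕_) (sym (⊕-identityˡ c))) eq))
combination₃≢vzero true false false a b c _ a≢0 _ _ _ _ _ _ eq =
  a≢0 (trans (sym (trans (cong (a ⊕_) (⊕-self vzero)) (⊕-identityʳ a))) eq)

∈⁅⁆∪ : ∀ {n} (a : Fin n) {W} → a ∈ ⁅ a ⁆ ∪ W
∈⁅⁆∪ a = SP.x∈p∪q⁺ (inj₁ (SP.x∈⁅x⁆ a))

∈-⁅⁆-lookup : ∀ {n} {Z : Subset n} {a y} → y ∈ Z → y ∈ ⁅ a ⁆ → lookup Z a ≡ true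
∈-⁅⁆-lookup {Z = Z} {a} y∈Z y∈⁅a⁆ = ∈⇒lookup (subst (_∈ Z) (SP.x∈⁅y⁆⇒x≡y a y∈⁅a⁆) y∈Z)

⊆pair-hit : ∀ {n} {Z : Subset n} {a b} → Z ⊆ ⁅ a ⁆ ∪ ⁅ b ⁆ → Nonempty Z →
  lookup Z a ≡ true ⊎ lookup Z b ≡ true
⊆pair-hit {a = a} {b} Z⊆ (y , y∈Z) with SP.x∈p∪q⁻ ⁅ a ⁆ ⁅ b ⁆ (Z⊆ y∈Z)
... | inj₁ y∈⁅a⁆ = inj₁ (∈-⁅⁆-lookup y∈Z y∈⁅a⁆)
... | inj₂ y∈⁅b⁆ = inj₂ (∈-⁅⁆-lookup y∈Z y∈⁅b⁆)

⊆triple-hit : ∀ {n} {Z : Subset n} {a b c} → Z ⊆ ⁅ a ⁆ ∪ ⁅ b ⁆ ∪ ⁅ c ⁆ → Nonempty Z →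
  lookup Z a ≡ true ⊎ lookup Z b ≡ true ⊎ lookup Z c ≡ true
⊆triple-hit {a = a} {b} {c} Z⊆ (y , y∈Z) with SP.x∈p∪q⁻ ⁅ a ⁆ _ (Z⊆ y∈Z)
... | inj₁ y∈⁅a⁆ = inj₁ (∈-⁅⁆-lookup y∈Z y∈⁅a⁆)
... | inj₂ y∈bc with SP.x∈p∪q⁻ ⁅ b ⁆ ⁅ c ⁆ y∈bc
...   | inj₁ y∈⁅b⁆ = inj₂ (inj₁ (∈-⁅⁆-lookup y∈Z y∈⁅b⁆))
...   | inj₂ y∈⁅c⁆ = inj₂ (inj₂ (∈-⁅⁆-lookup y∈Z y∈⁅c⁆))

linIndep-⁅⁆ : ∀ {n k} (φ : Fin n → V k) x → LinIndep φ ⁅ x ⁆ ⇔ φ x ≢ vzero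
linIndep-⁅⁆ φ x = mk⇔
  (λ li φx≡0 → li ⁅ x ⁆ (λ {_} h → h) (x , SP.x∈⁅x⁆ x) (trans (subsetSum-⁅⁆ φ x) φx≡0))
  (λ φx≢0 Z Z⊆ (y , y∈Z) sum≡0 → φx≢0 (begin
    φ x              ≡⟨ cong (_· φ x) (∈-⁅⁆-lookup y∈Z (Z⊆ y∈Z)) ⟨
    lookup Z x · φ x ≡⟨ subsetSum-⊆⁅⁆ φ x Z⊆ ⟨
    subsetSum φ Z    ≡⟨ sum≡0 ⟩
    vzero            ∎))

linIndep-pair⁺ : ∀ {n k} (φ : Fin n → V k) {a b} → a ≢ b →
  φ a ≢ vzero → φ b ≢ vzero → φ a ≢ φ b → LinIndep φ (⁅ a ⁆ ∪ ⁅ b ⁆)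
linIndep-pair⁺ φ {a} {b} a≢b φa≢0 φb≢0 φa≢φb Z Z⊆ Z≠∅ sum≡0 =
  combination₂≢vzero (lookup Z a) (lookup Z b) (φ a) (φ b) (⊆pair-hit Z⊆ Z≠∅) φa≢0 φb≢0 φa≢φb
    (trans (sym (subsetSum-⊆pair φ a b a≢b Z⊆)) sum≡0)

linIndep-pair⁻ : ∀ {n k} (φ : Fin n → V k) {a b} → a ≢ b →
  LinIndep φ (⁅ a ⁆ ∪ ⁅ b ⁆) → φ a ≢ φ b
linIndep-pair⁻ φ {a} {b} a≢b li φa≡φb = li _ (λ {_} h → h) (a , ∈⁅⁆∪ a) (begin
  subsetSum φ (⁅ a ⁆ ∪ ⁅ b ⁆)
    ≡⟨ subsetSum-⊆pair φ a b a≢b (λ {_} h → h) ⟩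
  lookup (⁅ a ⁆ ∪ ⁅ b ⁆) a · φ a ⊕ lookup (⁅ a ⁆ ∪ ⁅ b ⁆) b · φ b
    ≡⟨ cong₂ _⊕_ (∈⇒· (φ a) (∈⁅⁆∪ a)) (∈⇒· (φ b) (SP.q⊆p∪q ⁅ a ⁆ ⁅ b ⁆ (SP.x∈⁅x⁆ b))) ⟩
  φ a ⊕ φ b
    ≡⟨ cong (φ a ⊕_) φa≡φb ⟨
  φ a ⊕ φ a
    ≡⟨ ⊕-self (φ a) ⟩
  vzero ∎)

linIndep-triple⁺ : ∀ {n k} (φ : Fin n → V k) {a b c} → a ≢ b → a ≢ c → b ≢ c →
  φ a ≢ vzero → φ b ≢ vzero → φ c ≢ vzero → φ a ≢ φ b → φ a ≢ φ c → φ b ≢ φ c →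
  φ a ⊕ (φ b ⊕ φ c) ≢ vzero → LinIndep φ (⁅ a ⁆ ∪ ⁅ b ⁆ ∪ ⁅ c ⁆)
linIndep-triple⁺ φ {a} {b} {c} a≢b a≢c b≢c φa≢0 φb≢0 φc≢0 φa≢φb φa≢φc φb≢φc sum≢0
                 Z Z⊆ Z≠∅ sum≡0 =
  combination₃≢vzero (lookup Z a) (lookup Z b) (lookup Z c) (φ a) (φ b) (φ c) (⊆triple-hit Z⊆ Z≠∅)
    φa≢0 φb≢0 φc≢0 φa≢φb φa≢φc φb≢φc sum≢0
    (trans (sym (subsetSum-⊆triple φ a b c a≢b a≢c b≢c Z⊆)) sum≡0)

linIndep-triple⁻ : ∀ {n k} (φ : Fin n → V k) {a b c} → a ≢ b → a ≢ c → b ≢ c →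
  LinIndep φ (⁅ a ⁆ ∪ ⁅ b ⁆ ∪ ⁅ c ⁆) → φ a ⊕ (φ b ⊕ φ c) ≢ vzero
linIndep-triple⁻ {n} φ {a} {b} {c} a≢b a≢c b≢c li sum≡0 = li T (λ {_} h → h) (a , ∈⁅⁆∪ a) (begin
  subsetSum φ T
    ≡⟨ subsetSum-⊆triple φ a b c a≢b a≢c b≢c (λ {_} h → h) ⟩
  lookup T a · φ a ⊕ (lookup T b · φ b ⊕ lookup T c · φ c)
    ≡⟨ cong₂ (λ s t → s ⊕ (lookup T b · φ b ⊕ t)) (∈⇒· (φ a) (∈⁅⁆∪ a)) (∈⇒· (φ c) c∈T) ⟩
  φ a ⊕ (lookup T b · φ b ⊕ φ c)
    ≡⟨ cong (λ s → φ a ⊕ (s ⊕ φ c)) (∈⇒· (φ b) b∈T) ⟩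
  φ a ⊕ (φ b ⊕ φ c)
    ≡⟨ sum≡0 ⟩
  vzero ∎)
  where
  T : Subset n
  T = ⁅ a ⁆ ∪ ⁅ b ⁆ ∪ ⁅ c ⁆
  b∈T : b ∈ T
  b∈T = SP.q⊆p∪q ⁅ a ⁆ _ (∈⁅⁆∪ b)
  c∈T : c ∈ T
  c∈T = SP.q⊆p∪q ⁅ a ⁆ _ (SP.q⊆p∪q ⁅ b ⁆ ⁅ c ⁆ (SP.x∈⁅x⁆ c))

-- Binary expansions and the standard flat

bit : Bool → ℕ
bit true  = 1
bit false = 0

fromBits : ∀ {k} → V k → ℕ
fromBits []      = 0
fromBits (b ∷ v) = bit b + fromBits v * 2

bit<2 : ∀ b → bit b < 2
bit<2 true  = s≤s (s≤s z≤n)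
bit<2 false = s≤s z≤n

bit+x*2<2*y : ∀ b {x y} → x < y → bit b + x * 2 < 2 * y
bit+x*2<2*y b {x} {y} x<y = subst (bit b + x * 2 <_) (ℕP.*-comm y 2)
  (ℕP.<-≤-trans (ℕP.+-monoˡ-< (x * 2) (bit<2 b)) (ℕP.*-monoˡ-≤ 2 x<y))

bit+x*2<2*y⇒x<y : ∀ b {x y} → bit b + x * 2 < 2 * y → x < y
bit+x*2<2*y⇒x<y b {x} {y} lt = ℕP.*-cancelʳ-< 2 x y
  (ℕP.≤-<-trans (ℕP.m≤n+m (x * 2) (bit b)) (subst (bit b + x * 2 <_) (ℕP.*-comm 2 y) lt))

fromBits<2^k : ∀ {k} (v : V k) → fromBits v < 2 ^ k
fromBits<2^k []      = s≤s z≤n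
fromBits<2^k (b ∷ v) = bit+x*2<2*y b (fromBits<2^k v)

toBits-fromBits : ∀ {k} (v : V k) → toBits k (fromBits v) ≡ v
toBits-fromBits []      = refl
toBits-fromBits (b ∷ v) =
  cong₂ _∷_ (trans (cong (_≡ᵇ 1) (low b)) (bit≡ᵇ1 b)) (trans (cong (toBits _) (high b)) (toBits-fromBits v))
  where
  low : ∀ b → (bit b + fromBits v * 2) % 2 ≡ bit b
  low true  = [m+kn]%n≡m%n 1 (fromBits v) 2
  low false = [m+kn]%n≡m%n 0 (fromBits v) 2
  high : ∀ b → (bit b + fromBits v * 2) / 2 ≡ fromBits v
  high false = m*n/n≡m (fromBits v) 2
  high true  =
    trans (+-distrib-/ 1 (fromBits v * 2)
                       (subst (λ r → 1 + r < 2) (sym (m*n%n≡0 (fromBits v) 2)) (s≤s (s≤s z≤n))))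
                     (m*n/n≡m (fromBits v) 2)
  bit≡ᵇ1 : ∀ b → (bit b ≡ᵇ 1) ≡ b
  bit≡ᵇ1 true  = refl
  bit≡ᵇ1 false = refl

fromBits-toBits : ∀ k {n} → n < 2 ^ k → fromBits (toBits k n) ≡ n
fromBits-toBits zero    {zero}  _ = refl
fromBits-toBits zero    {suc n} (s≤s ())
fromBits-toBits (suc k) {n} n<2^k+1 = begin
  bit (n % 2 ≡ᵇ 1) + fromBits (toBits k (n / 2)) * 2
    ≡⟨ cong₂ _+_ (bit-parity (n % 2) (m%n<n n 2)) (cong (_* 2) (fromBits-toBits k n/2<2^k)) ⟩
  n % 2 + n / 2 * 2
    ≡⟨ m≡m%n+[m/n]*n n 2 ⟨
  n ∎
  where
  bit-parity : ∀ r → r < 2 → bit (r ≡ᵇ 1) ≡ r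
  bit-parity 0 _ = refl
  bit-parity 1 _ = refl
  bit-parity (suc (suc r)) (s≤s (s≤s ()))
  n/2<2^k : n / 2 < 2 ^ k
  n/2<2^k = m<n*o⇒m/o<n (subst (n <_) (ℕP.*-comm 2 (2 ^ k)) n<2^k+1)

fromBits≡0⇒≡vzero : ∀ {k} (v : V k) → fromBits v ≡ 0 → v ≡ vzero
fromBits≡0⇒≡vzero []          _  = refl
fromBits≡0⇒≡vzero (false ∷ v) eq =
  cong (false ∷_) (fromBits≡0⇒≡vzero v (ℕP.m*n≡0⇒m≡0 (fromBits v) 2 eq))

fromBits-vzero : ∀ k → fromBits (vzero {k}) ≡ 0
fromBits-vzero zero    = refl
fromBits-vzero (suc k) = cong (_* 2) (fromBits-vzero k)

InStdFlat : ∀ {k} → ℕ → V k → Set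
InStdFlat zero    v       = v ≡ vzero
InStdFlat (suc m) []      = ⊤
InStdFlat (suc m) (b ∷ v) = InStdFlat m v

inStdFlat? : ∀ {k} m (v : V k) → Dec (InStdFlat m v)
inStdFlat? zero    v       = v ≟V vzero
inStdFlat? (suc m) []      = yes tt
inStdFlat? (suc m) (b ∷ v) = inStdFlat? m v

inStdFlat-full : ∀ {k} (v : V k) → InStdFlat k v
inStdFlat-full []      = refl
inStdFlat-full (b ∷ v) = inStdFlat-full v

inStdFlat-vzero : ∀ {k} m → InStdFlat m (vzero {k})
inStdFlat-vzero         zero    = refl
inStdFlat-vzero {zero}  (suc m) = tt
inStdFlat-vzero {suc k} (suc m) = inStdFlat-vzero {k} m

inStdFlat-⊕ : ∀ {k} m {u v : V k} → InStdFlat m u → InStdFlat m v → InStdFlat m (u ⊕ v)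
inStdFlat-⊕ zero    refl refl = ⊕-self vzero
inStdFlat-⊕ (suc m) {[]}    {[]}    _  _  = tt
inStdFlat-⊕ (suc m) {a ∷ u} {b ∷ v} hu hv = inStdFlat-⊕ m hu hv

inStdFlat⇔fromBits<2^m : ∀ {k} m (v : V k) → InStdFlat m v ⇔ fromBits v < 2 ^ m
inStdFlat⇔fromBits<2^m m v = mk⇔ (to′ m v) (from′ m v)
  where
  to′ : ∀ {k} m (v : V k) → InStdFlat m v → fromBits v < 2 ^ m
  to′ {k} zero    v       refl = subst (_< 1) (sym (fromBits-vzero k)) (s≤s z≤n)
  to′     (suc m) []      _    = ℕP.m^n>0 2 (suc m)
  to′     (suc m) (b ∷ v) in-v = bit+x*2<2*y b (to′ m v in-v)
  from′ : ∀ {k} m (v : V k) → fromBits v < 2 ^ m → InStdFlat m v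
  from′ zero    v       (s≤s v≤0) = fromBits≡0⇒≡vzero v (ℕP.n≤0⇒n≡0 v≤0)
  from′ (suc m) []      _         = tt
  from′ (suc m) (b ∷ v) lt        = from′ m v (bit+x*2<2*y⇒x<y b lt)

inStdFlat-insertAt-false : ∀ {k} (y : V k) (p : Fin (suc k)) →
  InStdFlat (toℕ p) (insertAt y p false) ⇔ InStdFlat (toℕ p) y
inStdFlat-insertAt-false y       fzero    = mk⇔ VP.∷-injectiveʳ (cong (false ∷_))
inStdFlat-insertAt-false (_ ∷ y) (fsuc p) = inStdFlat-insertAt-false y p

¬inStdFlat-insertAt-true : ∀ {k} (y : V k) (p : Fin (suc k)) → ¬ InStdFlat (toℕ p) (insertAt y p true)
¬inStdFlat-insertAt-true y       fzero    ()
¬inStdFlat-insertAt-true (_ ∷ y) (fsuc p) = ¬inStdFlat-insertAt-true y p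

insertAt-vzero : ∀ {k} (p : Fin (suc k)) → insertAt (vzero {k}) p false ≡ vzero
insertAt-vzero         fzero    = refl
insertAt-vzero {suc k} (fsuc p) = cong (false ∷_) (insertAt-vzero p)

⊕-insertAt : ∀ {k} (u v : V k) (p : Fin (suc k)) a b →
  insertAt u p a ⊕ insertAt v p b ≡ insertAt (u ⊕ v) p (a xor b)
⊕-insertAt u       v       fzero    a b = refl
⊕-insertAt (x ∷ u) (y ∷ v) (fsuc p) a b = cong ((x xor y) ∷_) (⊕-insertAt u v p a b)

removeAt-⊕ : ∀ {k} (u v : V (suc k)) (p : Fin (suc k)) → removeAt (u ⊕ v) p ≡ removeAt u p ⊕ removeAt v p
removeAt-⊕ u v p = begin
  removeAt (u ⊕ v) p
    ≡⟨ cong (λ w → removeAt w p) (cong₂ _⊕_ (VP.insertAt-removeAt u p) (VP.insertAt-removeAt v p)) ⟨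
  removeAt (insertAt (removeAt u p) p (lookup u p) ⊕ insertAt (removeAt v p) p (lookup v p)) p
    ≡⟨ cong (λ w → removeAt w p) (⊕-insertAt (removeAt u p) (removeAt v p) p _ _) ⟩
  removeAt (insertAt (removeAt u p ⊕ removeAt v p) p _) p
    ≡⟨ VP.removeAt-insertAt _ p _ ⟩
  removeAt u p ⊕ removeAt v p ∎

-- Subspaces in standard form

record StdForm (K : ℕ) (F : V K → Set) : Set where
  field
    dim      : ℕ
    dim≤K    : dim ≤ K
    A        : V K → V K
    A⁻¹      : V K → V K
    A-linear : Linear A
    A⁻¹∘A    : ∀ v → A⁻¹ (A v) ≡ v
    A∘A⁻¹    : ∀ v → A (A⁻¹ v) ≡ v
    F⇔       : ∀ v → F v ⇔ InStdFlat dim (A v)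

-- If F contains some true ∷ w₀, subtracting w₀ reduces F to its part with head false.
stdForm-extend : ∀ {K} {F : V (suc K) → Set} → Closed⊕ F → ∀ {w₀} → F (true ∷ w₀) →
  StdForm K (F ∘ (false ∷_)) → StdForm (suc K) F
stdForm-extend {K} {F} F⊕ {w₀} Fw₀ R = record
  { dim = suc R.dim ; dim≤K = s≤s R.dim≤K ; A = A ; A⁻¹ = A⁻¹ ; A-linear = A-linear
  ; A⁻¹∘A = A⁻¹∘A ; A∘A⁻¹ = A∘A⁻¹ ; F⇔ = F⇔ }
  where
  module R = StdForm R
  A : V (suc K) → V (suc K)
  A (b ∷ w) = b ∷ R.A (w ⊕ b · w₀)
  A⁻¹ : V (suc K) → V (suc K)
  A⁻¹ (b ∷ y) = b ∷ R.A⁻¹ y ⊕ b · w₀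
  A-linear : Linear A
  A-linear (a ∷ u) (b ∷ v) = cong ((a xor b) ∷_) (begin
    R.A (u ⊕ v ⊕ (a xor b) · w₀)          ≡⟨ cong (λ x → R.A (u ⊕ v ⊕ x)) (·-distribʳ-xor a b w₀) ⟩
    R.A (u ⊕ v ⊕ (a · w₀ ⊕ b · w₀))       ≡⟨ cong R.A (⊕-interchange u v _ _) ⟩
    R.A (u ⊕ a · w₀ ⊕ (v ⊕ b · w₀))       ≡⟨ R.A-linear _ _ ⟩
    R.A (u ⊕ a · w₀) ⊕ R.A (v ⊕ b · w₀)   ∎)
  A⁻¹∘A : ∀ v → A⁻¹ (A v) ≡ v
  A⁻¹∘A (b ∷ w) = cong (b ∷_) (trans (cong (_⊕ b · w₀) (R.A⁻¹∘A _)) (⊕-cancelʳ w (b · w₀)))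
  A∘A⁻¹ : ∀ v → A (A⁻¹ v) ≡ v
  A∘A⁻¹ (b ∷ y) = cong (b ∷_) (trans (cong R.A (⊕-cancelʳ (R.A⁻¹ y) (b · w₀))) (R.A∘A⁻¹ y))
  F⇔ : ∀ v → F v ⇔ InStdFlat (suc R.dim) (A v)
  F⇔ (false ∷ w) = mk⇔
    (λ Fv → to (R.F⇔ _) (subst (F ∘ (false ∷_)) (sym (⊕-identityʳ w)) Fv))
    (λ in-v → subst (F ∘ (false ∷_)) (⊕-identityʳ w) (from (R.F⇔ _) in-v))
  F⇔ (true ∷ w) = mk⇔
    (λ Fv → to (R.F⇔ _) (F⊕ Fv Fw₀))
    (λ in-v → subst (F ∘ (true ∷_)) (⊕-cancelʳ w w₀) (F⊕ (from (R.F⇔ _) in-v) Fw₀))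

-- If F lies in the hyperplane of head false, the head coordinate is moved to position dim.
stdForm-shift : ∀ {K} {F : V (suc K) → Set} → (∀ w → ¬ F (true ∷ w)) →
  StdForm K (F ∘ (false ∷_)) → StdForm (suc K) F
stdForm-shift {K} {F} ¬F-true R = record
  { dim = R.dim ; dim≤K = ℕP.m≤n⇒m≤1+n R.dim≤K ; A = A ; A⁻¹ = A⁻¹ ; A-linear = A-linear
  ; A⁻¹∘A = A⁻¹∘A ; A∘A⁻¹ = A∘A⁻¹ ; F⇔ = F⇔ }
  where
  module R = StdForm R
  p : Fin (suc K)
  p = fromℕ< (s≤s R.dim≤K)
  p≡dim : toℕ p ≡ R.dim
  p≡dim = FP.toℕ-fromℕ< (s≤s R.dim≤K)
  A : V (suc K) → V (suc K)
  A (b ∷ w) = insertAt (R.A w) p b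
  A⁻¹ : V (suc K) → V (suc K)
  A⁻¹ v = lookup v p ∷ R.A⁻¹ (removeAt v p)
  A-linear : Linear A
  A-linear (a ∷ u) (b ∷ v) =
    trans (cong (λ x → insertAt x p (a xor b)) (R.A-linear u v)) (sym (⊕-insertAt _ _ p a b))
  A⁻¹∘A : ∀ v → A⁻¹ (A v) ≡ v
  A⁻¹∘A (b ∷ w) =
    cong₂ _∷_ (VP.insertAt-lookup (R.A w) p b)
              (trans (cong R.A⁻¹ (VP.removeAt-insertAt (R.A w) p b)) (R.A⁻¹∘A w))
  A∘A⁻¹ : ∀ v → A (A⁻¹ v) ≡ v
  A∘A⁻¹ v =
    trans (cong (λ x → insertAt x p (lookup v p)) (R.A∘A⁻¹ (removeAt v p))) (VP.insertAt-removeAt v p)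
  F⇔ : ∀ v → F v ⇔ InStdFlat R.dim (A v)
  F⇔ (false ∷ w) = ⇔.trans (R.F⇔ w)
    (⇔.sym (subst (λ d → InStdFlat d (A (false ∷ w)) ⇔ InStdFlat d (R.A w)) p≡dim
                  (inStdFlat-insertAt-false (R.A w) p)))
  F⇔ (true ∷ w)  = mk⇔ (λ Fv → contradiction Fv (¬F-true w))
                       (λ in-v → contradiction (subst (λ d → InStdFlat d (A (true ∷ w))) (sym p≡dim) in-v)
                                               (¬inStdFlat-insertAt-true (R.A w) p))

stdForm : ∀ K (F : V K → Set) → (∀ v → Dec (F v)) → F vzero → Closed⊕ F → StdForm K F
stdForm zero    F F? F0 F⊕ = record
  { dim = 0 ; dim≤K = z≤n ; A = id ; A⁻¹ = id ; A-linear = λ _ _ → refl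
  ; A⁻¹∘A = λ _ → refl ; A∘A⁻¹ = λ _ → refl ; F⇔ = λ { [] → mk⇔ (λ _ → refl) (λ _ → F0) } }
stdForm (suc K) F F? F0 F⊕ = case SP.anySubset? (F? ∘ (true ∷_)) of λ where
    (yes (w₀ , Fw₀)) → stdForm-extend F⊕ Fw₀ R
    (no ¬F-true)     → stdForm-shift (λ w Fw → ¬F-true (w , Fw)) R
  where
  R : StdForm K (F ∘ (false ∷_))
  R = stdForm K (F ∘ (false ∷_)) (F? ∘ (false ∷_)) F0 F⊕

-- Contraction as a quotient

-- q v clears a coordinate t where u is 1 by adding u if necessary, and then deletes it.
module Quotient {r : ℕ} (u : V (suc r)) (u≢0 : u ≢ vzero) where

  t : Fin (suc r)
  t = proj₁ (≢vzero⇒∃true u u≢0)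

  u[t] : lookup u t ≡ true
  u[t] = proj₂ (≢vzero⇒∃true u u≢0)

  clear : V (suc r) → V (suc r)
  clear v = v ⊕ lookup v t · u

  q : V (suc r) → V r
  q v = removeAt (clear v) t

  lift : V r → V (suc r)
  lift w = insertAt w t false

  clear-t : ∀ v → lookup (clear v) t ≡ false
  clear-t v = trans (lookup-⊕ v _ t) (cases (lookup v t))
    where
    cases : ∀ b → b xor lookup (b · u) t ≡ false
    cases true  = cong not u[t]
    cases false = lookup-vzero t

  clear-linear : Linear clear
  clear-linear v w = begin
    v ⊕ w ⊕ lookup (v ⊕ w) t · u
      ≡⟨ cong (λ b → v ⊕ w ⊕ b · u) (lookup-⊕ v w t) ⟩
    v ⊕ w ⊕ (lookup v t xor lookup w t) · u
      ≡⟨ cong (v ⊕ w ⊕_) (·-distribʳ-xor (lookup v t) (lookup w t) u) ⟩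
    v ⊕ w ⊕ (lookup v t · u ⊕ lookup w t · u)
      ≡⟨ ⊕-interchange v w _ _ ⟩
    clear v ⊕ clear w ∎

  q-linear : Linear q
  q-linear v w = trans (cong (λ x → removeAt x t) (clear-linear v w)) (removeAt-⊕ (clear v) (clear w) t)

  q-vzero : q vzero ≡ vzero
  q-vzero = linear-vzero q-linear

  q-u : q u ≡ vzero
  q-u = begin
    removeAt (u ⊕ lookup u t · u) t ≡⟨ cong (λ b → removeAt (u ⊕ b · u) t) u[t] ⟩
    removeAt (u ⊕ u) t              ≡⟨ cong (λ x → removeAt x t) (⊕-self u) ⟩
    removeAt vzero t                ≡⟨ cong (λ x → removeAt x t) (insertAt-vzero t) ⟨
    removeAt (insertAt vzero t false) t ≡⟨ VP.removeAt-insertAt vzero t false ⟩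
    vzero                           ∎

  q-kernel : ∀ v → q v ≡ vzero → v ≡ vzero ⊎ v ≡ u
  q-kernel v qv≡0 = cases (lookup v t) refl
    where
    clear≡0 : clear v ≡ vzero
    clear≡0 = begin
      clear v                                         ≡⟨ VP.insertAt-removeAt (clear v) t ⟨
      insertAt (q v) t (lookup (clear v) t)           ≡⟨ cong₂ (λ w b → insertAt w t b) qv≡0 (clear-t v) ⟩
      insertAt vzero t false                          ≡⟨ insertAt-vzero t ⟩
      vzero                                           ∎
    cases : ∀ b → lookup v t ≡ b → v ≡ vzero ⊎ v ≡ u
    cases true  v[t] = inj₂ (⊕≡vzero⇒≡ (trans (cong (λ b → v ⊕ b · u) (sym v[t])) clear≡0))
    cases false v[t] =
      inj₁ (trans (sym (⊕-identityʳ v)) (trans (cong (λ b → v ⊕ b · u) (sym v[t])) clear≡0))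

  q-lift : ∀ w → q (lift w) ≡ w
  q-lift w = begin
    removeAt (lift w ⊕ lookup (lift w) t · u) t
      ≡⟨ cong (λ b → removeAt (lift w ⊕ b · u) t) (VP.insertAt-lookup w t false) ⟩
    removeAt (lift w ⊕ vzero) t
      ≡⟨ cong (λ x → removeAt x t) (⊕-identityʳ (lift w)) ⟩
    removeAt (lift w) t
      ≡⟨ VP.removeAt-insertAt w t false ⟩
    w ∎

  q-⊕u : ∀ v → q (v ⊕ u) ≡ q v
  q-⊕u v = trans (q-linear v u) (trans (cong (q v ⊕_) q-u) (⊕-identityʳ (q v)))

  q-≡ : ∀ v w → q v ≡ q w → v ≡ w ⊎ v ⊕ w ≡ u
  q-≡ v w qv≡qw
    with q-kernel (v ⊕ w) (trans (q-linear v w) (trans (cong (q v ⊕_) (sym qv≡qw)) (⊕-self (q v))))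
  ... | inj₁ v⊕w≡0 = inj₁ (⊕≡vzero⇒≡ v⊕w≡0)
  ... | inj₂ v⊕w≡u = inj₂ v⊕w≡u

  q-≢vzero : ∀ {v} → v ≢ vzero → v ≢ u → q v ≢ vzero
  q-≢vzero v≢0 v≢u qv≡0 with q-kernel _ qv≡0
  ... | inj₁ v≡0 = v≢0 v≡0
  ... | inj₂ v≡u = v≢u v≡u

record IsSimpleConfig {n k} (c : Fin n → V k) : Set where
  field
    injective : Injective _≡_ _≡_ c
    nonzero   : ∀ x → c x ≢ vzero

IsPoint : ∀ {n k} → (Fin n → V k) → V k → Set
IsPoint c v = ∃[ x ] c x ≡ v

isPoint? : ∀ {n k} (c : Fin n → V k) v → Dec (IsPoint c v)
isPoint? c v = FP.any? (λ x → c x ≟V v)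

module Contraction {n r} {c : Fin n → V (suc r)} (simple : IsSimpleConfig c) (e : Fin n) where
  open IsSimpleConfig simple
  open Quotient (c e) (nonzero e) public

  I : IndepPred n
  I = contract (LinIndep c) e

  linIndep-∪⁅e⁆⇒ : ∀ {X} → e ∉ X → LinIndep c (X ∪ ⁅ e ⁆) → LinIndep (q ∘ c) X
  linIndep-∪⁅e⁆⇒ {X} e∉X li Z Z⊆X Z≠∅ qΣ≡0
    with q-kernel (subsetSum c Z) (trans (sym (subsetSum-map q-linear c Z)) qΣ≡0)
  ... | inj₁ Σ≡0  = li Z (SP.p⊆p∪q ⁅ e ⁆ ∘ Z⊆X) Z≠∅ Σ≡0
  ... | inj₂ Σ≡ce = li (Z [ e ]≔ true) Z+e⊆ (e , lookup⇒∈ (VP.lookup∘update e Z true)) (begin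
    subsetSum c (Z [ e ]≔ true) ≡⟨ subsetSum-[]≔true c (e∉X ∘ Z⊆X) ⟩
    c e ⊕ subsetSum c Z         ≡⟨ cong (c e ⊕_) Σ≡ce ⟩
    c e ⊕ c e                   ≡⟨ ⊕-self (c e) ⟩
    vzero                       ∎)
    where
    Z+e⊆ : Z [ e ]≔ true ⊆ X ∪ ⁅ e ⁆
    Z+e⊆ y∈ with ∈-[]≔true⁻ y∈
    ... | inj₁ refl = SP.q⊆p∪q X ⁅ e ⁆ (SP.x∈⁅x⁆ e)
    ... | inj₂ y∈Z  = SP.p⊆p∪q ⁅ e ⁆ (Z⊆X y∈Z)

  linIndep-∪⁅e⁆⇐ : ∀ {X} → LinIndep (q ∘ c) X → LinIndep c (X ∪ ⁅ e ⁆)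
  linIndep-∪⁅e⁆⇐ {X} li Z Z⊆ (y , y∈Z) Σ≡0 = cases (SP.nonempty? Z−e)
    where
    Z−e : Subset n
    Z−e = Z [ e ]≔ false
    Σ−e : lookup Z e · c e ≡ subsetSum c Z−e
    Σ−e = ⊕≡vzero⇒≡ (trans (sym (subsetSum-split c Z e)) Σ≡0)
    cases : Dec (Nonempty Z−e) → ⊥
    cases (yes Z−e≠∅) = li Z−e ([]≔false-⊆ (∈∪⁅⁆-drop ∘ Z⊆)) Z−e≠∅ (begin
      subsetSum (q ∘ c) Z−e     ≡⟨ subsetSum-map q-linear c Z−e ⟩
      q (subsetSum c Z−e)       ≡⟨ cong q Σ−e ⟨
      q (lookup Z e · c e)      ≡⟨ linear-· q-linear (lookup Z e) (c e) ⟩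
      lookup Z e · q (c e)      ≡⟨ cong (lookup Z e ·_) q-u ⟩
      lookup Z e · vzero        ≡⟨ ·-vzero (lookup Z e) ⟩
      vzero                     ∎)
    cases (no Z−e-empty) = Z-empty (y , y∈Z)
      where
      e∉Z : e ∉ Z
      e∉Z e∈Z = nonzero e (begin
        c e                 ≡⟨ ∈⇒· (c e) e∈Z ⟨
        lookup Z e · c e    ≡⟨ Σ−e ⟩
        subsetSum c Z−e     ≡⟨ subsetSum-empty c Z−e-empty ⟩
        vzero               ∎)
      Z-empty : Empty Z
      Z-empty (x , x∈Z) with x FP.≟ e
      ... | yes refl = e∉Z x∈Z
      ... | no x≢e   = Z−e-empty (x , ∈-[]≔false⁺ x∈Z x≢e)

  contract⇔ : ∀ {X} → e ∉ X → I X ⇔ LinIndep (q ∘ c) X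
  contract⇔ e∉X =
    mk⇔ (λ (_ , li) → linIndep-∪⁅e⁆⇒ e∉X li) (λ li → e∉X , linIndep-∪⁅e⁆⇐ li)

  q∘c-≢vzero : ∀ {x} → x ≢ e → q (c x) ≢ vzero
  q∘c-≢vzero x≢e = q-≢vzero (nonzero _) (x≢e ∘ injective)

  loop⇔≡e : ∀ x → Loop I x ⇔ x ≡ e
  loop⇔≡e x = mk⇔ loop⇒≡e λ { refl (e∉⁅e⁆ , _) → e∉⁅e⁆ (SP.x∈⁅x⁆ e) }
    where
    loop⇒≡e : Loop I x → x ≡ e
    loop⇒≡e loop with x FP.≟ e
    ... | yes x≡e = x≡e
    ... | no x≢e  = contradiction (from (contract⇔ (SP.x≢y⇒x∉⁅y⁆ (x≢e ∘ sym)))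
                                         (from (linIndep-⁅⁆ (q ∘ c) x) (q∘c-≢vzero x≢e))) loop

  e∉pair : ∀ {x y} → x ≢ e → y ≢ e → e ∉ ⁅ x ⁆ ∪ ⁅ y ⁆
  e∉pair x≢e y≢e e∈ with SP.x∈p∪q⁻ _ _ e∈
  ... | inj₁ e∈⁅x⁆ = x≢e (sym (SP.x∈⁅y⁆⇒x≡y _ e∈⁅x⁆))
  ... | inj₂ e∈⁅y⁆ = y≢e (sym (SP.x∈⁅y⁆⇒x≡y _ e∈⁅y⁆))

  parallel⇔ : ∀ {x y} → x ≢ e → y ≢ e → Parallel I x y ⇔ q (c x) ≡ q (c y)
  parallel⇔ {x} {y} x≢e y≢e = mk⇔ parallel⇒ parallel⇐
    where
    nonloop : ∀ {z} → z ≢ e → ¬ Loop I z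
    nonloop z≢e = z≢e ∘ to (loop⇔≡e _)
    parallel⇒ : Parallel I x y → q (c x) ≡ q (c y)
    parallel⇒ (_ , _ , inj₁ refl) = refl
    parallel⇒ (_ , _ , inj₂ dependent) with x FP.≟ y | q (c x) ≟V q (c y)
    ... | yes refl | _       = refl
    ... | no _     | yes eq  = eq
    ... | no x≢y   | no qx≢qy = contradiction (from (contract⇔ (e∉pair x≢e y≢e))
      (linIndep-pair⁺ (q ∘ c) x≢y (q∘c-≢vzero x≢e) (q∘c-≢vzero y≢e) qx≢qy)) dependent
    parallel⇐ : q (c x) ≡ q (c y) → Parallel I x y
    parallel⇐ qx≡qy with x FP.≟ y
    ... | yes x≡y = nonloop x≢e , nonloop y≢e , inj₁ x≡y
    ... | no x≢y  = nonloop x≢e , nonloop y≢e ,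
                    inj₂ (λ indep → linIndep-pair⁻ (q ∘ c) x≢y
                                      (to (contract⇔ (e∉pair x≢e y≢e)) indep) qx≡qy)

contract-cong : ∀ {n} {I J : IndepPred n} → (∀ X → I X ⇔ J X) → ∀ e X →
  contract I e X ⇔ contract J e X
contract-cong I⇔J e X =
  mk⇔ (λ (e∉X , i) → e∉X , to (I⇔J _) i) (λ (e∉X , j) → e∉X , from (I⇔J _) j)

loop-cong : ∀ {n} {I J : IndepPred n} → (∀ X → I X ⇔ J X) → ∀ x → Loop I x ⇔ Loop J x
loop-cong I⇔J x = mk⇔ (λ ¬i j → ¬i (from (I⇔J _) j)) (λ ¬j i → ¬j (to (I⇔J _) i))

parallel-cong : ∀ {n} {I J : IndepPred n} → (∀ X → I X ⇔ J X) → ∀ x y →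
  Parallel I x y → Parallel J x y
parallel-cong I⇔J x y (¬loop-x , ¬loop-y , same) =
  ¬loop-x ∘ from (loop-cong I⇔J x) , ¬loop-y ∘ from (loop-cong I⇔J y) ,
  Data.Sum.map id (λ ¬i j → ¬i (from (I⇔J _) j)) same

SiIso-cong : ∀ {n m} {I J : IndepPred n} {P : IndepPred m} → (∀ X → I X ⇔ J X) → SiIso I P → SiIso J P
SiIso-cong {I = I} {J} I⇔J (f , nonloop , reps-distinct , reps-cover , f-iso) =
  f , (λ j → nonloop j ∘ from (loop-cong I⇔J (f j))) ,
  (λ j j′ par → reps-distinct j j′ (parallel-cong J⇔I _ _ par)) ,
  (λ x ¬loop → let j , par = reps-cover x (¬loop ∘ to (loop-cong I⇔J x)) in j , parallel-cong I⇔J _ _ par) ,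
  (λ Y X im → ⇔.trans (f-iso Y X im) (I⇔J X))
  where
  J⇔I : ∀ X → J X ⇔ I X
  J⇔I X = ⇔.sym (I⇔J X)

-- Deleted projective geometries

a<b∸c⇒a+c<b : ∀ {a b c} → c ≤ b → a < b ∸ c → a + c < b
a<b∸c⇒a+c<b {a} {b} {c} c≤b a<b∸c = subst (a + c <_) (ℕP.m∸n+n≡m c≤b) (ℕP.+-monoˡ-< c a<b∸c)

module DeletedPG (K m : ℕ) (m≤K : m ≤ K) where

  point : Fin (2 ^ K ∸ 2 ^ m) → V K
  point = pgDelVec K m

  fromBits-point : ∀ j → fromBits (point j) ≡ toℕ j + 2 ^ m
  fromBits-point j = fromBits-toBits K (a<b∸c⇒a+c<b (ℕP.^-monoʳ-≤ 2 m≤K) (FP.toℕ<n j))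

  point-∉flat : ∀ j → ¬ InStdFlat m (point j)
  point-∉flat j in-flat =
    ℕP.<⇒≱ (subst (_< 2 ^ m) (fromBits-point j) (to (inStdFlat⇔fromBits<2^m m (point j)) in-flat))
           (ℕP.m≤n+m (2 ^ m) (toℕ j))

  point-onto : ∀ v → ¬ InStdFlat m v → IsPoint point v
  point-onto v v∉flat = fromℕ< v−2^m<N , (begin
    toBits K (toℕ (fromℕ< v−2^m<N) + 2 ^ m) ≡⟨ cong (λ i → toBits K (i + 2 ^ m)) (FP.toℕ-fromℕ< v−2^m<N) ⟩
    toBits K (fromBits v ∸ 2 ^ m + 2 ^ m)    ≡⟨ cong (toBits K) (ℕP.m∸n+n≡m 2^m≤v) ⟩
    toBits K (fromBits v)                    ≡⟨ toBits-fromBits v ⟩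
    v                                        ∎)
    where
    2^m≤v : 2 ^ m ≤ fromBits v
    2^m≤v = ℕP.≮⇒≥ (v∉flat ∘ from (inStdFlat⇔fromBits<2^m m v))
    v−2^m<N : fromBits v ∸ 2 ^ m < 2 ^ K ∸ 2 ^ m
    v−2^m<N = ℕP.∸-monoˡ-< (fromBits<2^k v) 2^m≤v

  point-simple : IsSimpleConfig point
  point-simple = record
    { injective = λ {i} {j} eq → FP.toℕ-injective (ℕP.+-cancelʳ-≡ (2 ^ m) (toℕ i) (toℕ j)
                    (trans (sym (fromBits-point i)) (trans (cong fromBits eq) (fromBits-point j))))
    ; nonzero   = λ j eq → point-∉flat j (subst (InStdFlat m) (sym eq) (inStdFlat-vzero m))
    }

module PGPoints (r : ℕ) = DeletedPG r 0 z≤n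

linIndep-preimage : ∀ {n N k} (d : Fin N → V k) (σ : Fin n ↔ Fin N) X →
  LinIndep (d ∘ Inverse.to σ) X ⇔ LinIndep d (preimage (Inverse.from σ) X)
linIndep-preimage d σ X = linIndep-image d (Injection.injective (Inverse⇒Injection σ)) image-σ
  where
  open Inverse σ using (strictlyInverseˡ; strictlyInverseʳ)
  image-σ : IsImage (Inverse.to σ) X (preimage (Inverse.from σ) X)
  image-σ j = mk⇔
    (λ j∈ → Inverse.from σ j , to ∈-preimage j∈ , strictlyInverseˡ j)
    (λ { (x , x∈X , refl) → from ∈-preimage (subst (_∈ X) (sym (strictlyInverseʳ x)) x∈X) })

sameImage⇒≅ : ∀ {n N k} {c : Fin n → V k} {d : Fin N → V k} →
  Injective _≡_ _≡_ c → Injective _≡_ _≡_ d → (∀ x → IsPoint d (c x)) → (∀ j → IsPoint c (d j)) →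
  LinIndep c ≅ LinIndep d
sameImage⇒≅ {n} {N} {c = c} {d} c-inj d-inj c⊆d d⊆c =
  σ , λ X → ⇔.trans (linIndep-cong (sym ∘ d∘σ≗c) X) (linIndep-preimage d σ X)
  where
  σ : Fin n ↔ Fin N
  σ = mk↔ₛ′ (proj₁ ∘ c⊆d) (proj₁ ∘ d⊆c)
            (λ j → d-inj (trans (proj₂ (c⊆d _)) (proj₂ (d⊆c j))))
            (λ x → c-inj (trans (proj₂ (d⊆c _)) (proj₂ (c⊆d x))))
  d∘σ≗c : ∀ x → d (Inverse.to σ x) ≡ c x
  d∘σ≗c x = proj₂ (c⊆d x)

≅-respˡ : ∀ {n m} {I J : IndepPred n} {P : IndepPred m} → (∀ X → I X ⇔ J X) → J ≅ P → I ≅ P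
≅-respˡ I⇔J (σ , J≅P) = σ , λ X → ⇔.trans (I⇔J X) (J≅P X)

-- Lines through a point

MeetsLinesThrough : ∀ {n k} → (Fin n → V k) → Fin n → Set
MeetsLinesThrough c e = ∀ v → v ≢ vzero → v ≢ c e → IsPoint c v ⊎ IsPoint c (v ⊕ c e)

nonPoints-closed⇒meetsLines : ∀ {n k} {c : Fin n → V k} → Closed⊕ (¬_ ∘ IsPoint c) →
  ∀ e → MeetsLinesThrough c e
nonPoints-closed⇒meetsLines {c = c} closed e v _ _ with isPoint? c v | isPoint? c (v ⊕ c e)
... | yes v-point | _           = inj₁ v-point
... | no _        | yes w-point = inj₂ w-point
... | no ¬v-point | no ¬w-point = contradiction (e , sym (⊕-cancelˡ v (c e))) (closed ¬v-point ¬w-point)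

meetsLines⇒nonPoints-closed : ∀ {n k} {c : Fin n → V k} → (∀ e → MeetsLinesThrough c e) →
  Closed⊕ (¬_ ∘ IsPoint c)
meetsLines⇒nonPoints-closed {c = c} meets {u} {v} ¬u-point ¬v-point (x , cx≡u⊕v)
  with u ≟V vzero | v ≟V vzero
... | yes refl | _        = ¬v-point (x , trans cx≡u⊕v (⊕-identityˡ v))
... | no _     | yes refl = ¬u-point (x , trans cx≡u⊕v (⊕-identityʳ u))
... | no u≢0   | no v≢0 with meets x u u≢0 (λ u≡cx → v≢0 (⊕≡ˡ⇒≡vzero (trans (sym cx≡u⊕v) (sym u≡cx))))
...   | inj₁ u-point        = ¬u-point u-point
...   | inj₂ (y , cy≡u⊕cx) = ¬v-point (y , trans cy≡u⊕cx (trans (cong (u ⊕_) cx≡u⊕v) (⊕-cancelˡ u v)))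

meetsLines⇒contraction≅PG : ∀ {n r} {c : Fin n → V (suc r)} → IsSimpleConfig c → ∀ e →
  MeetsLinesThrough c e → SiIso (contract (LinIndep c) e) (PG r)
meetsLines⇒contraction≅PG {n} {r} {c} simple e meets = f , f-nonloop , reps-distinct , reps-cover , f-iso
  where
  open Contraction simple e
  open PGPoints r using (point; point-onto; point-simple)
  open IsSimpleConfig point-simple renaming (injective to point-injective; nonzero to point-nonzero)

  lifted-point : ∀ j → IsPoint c (lift (point j)) ⊎ IsPoint c (lift (point j) ⊕ c e)
  lifted-point j = meets (lift (point j))
    (λ eq → point-nonzero j (trans (sym (q-lift _)) (trans (cong q eq) q-vzero)))
    (λ eq → point-nonzero j (trans (sym (q-lift _)) (trans (cong q eq) q-u)))

  f : Fin (2 ^ r ∸ 1) → Fin n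
  f j = Data.Sum.[ proj₁ , proj₁ ] (lifted-point j)

  q∘c∘f : ∀ j → q (c (f j)) ≡ point j
  q∘c∘f j with lifted-point j
  ... | inj₁ (_ , eq) = trans (cong q eq) (q-lift _)
  ... | inj₂ (_ , eq) = trans (cong q eq) (trans (q-⊕u (lift (point j))) (q-lift _))

  f≢e : ∀ j → f j ≢ e
  f≢e j fj≡e = point-nonzero j (trans (sym (q∘c∘f j)) (trans (cong (q ∘ c) fj≡e) q-u))

  f-nonloop : ∀ j → ¬ Loop I (f j)
  f-nonloop j = f≢e j ∘ to (loop⇔≡e _)

  reps-distinct : ∀ j j′ → Parallel I (f j) (f j′) → j ≡ j′
  reps-distinct j j′ par =
    point-injective (trans (sym (q∘c∘f j)) (trans (to (parallel⇔ (f≢e j) (f≢e j′)) par) (q∘c∘f j′)))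

  reps-cover : ∀ x → ¬ Loop I x → ∃[ j ] Parallel I x (f j)
  reps-cover x ¬loop =
    let x≢e        = ¬loop ∘ from (loop⇔≡e x)
        j , pj≡qcx = point-onto (q (c x)) (q∘c-≢vzero x≢e)
    in j , from (parallel⇔ x≢e (f≢e j)) (trans (sym pj≡qcx) (sym (q∘c∘f j)))

  f-iso : ∀ Y X → IsImage f Y X → PG r Y ⇔ I X
  f-iso Y X im =
    ⇔.trans (linIndep-cong (sym ∘ q∘c∘f) Y)
            (⇔.trans (linIndep-image (q ∘ c) f-injective im) (⇔.sym (contract⇔ e∉X)))
    where
    f-injective : Injective _≡_ _≡_ f
    f-injective eq = point-injective (trans (sym (q∘c∘f _)) (trans (cong (q ∘ c) eq) (q∘c∘f _)))
    e∉X : e ∉ X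
    e∉X e∈X = let j , _ , fj≡e = to (im e) e∈X in f≢e j fj≡e

PointOrZero : ∀ {n k} → (Fin n → V k) → V k → Set
PointOrZero g v = v ≡ vzero ⊎ IsPoint g v

-- The third point on the line through two points of PG(r-1,2) is their sum; independence of
-- triples carries this over to g.
pgLike⇒closed : ∀ {r} {g : Fin (2 ^ r ∸ 1) → V r} → (∀ Y → PG r Y ⇔ LinIndep g Y) →
  Closed⊕ (PointOrZero g)
pgLike⇒closed {r} {g} PG⇔g = closed
  where
  open PGPoints r using (point; point-onto; point-simple)
  open IsSimpleConfig point-simple renaming (injective to point-injective; nonzero to point-nonzero)

  g-nonzero : ∀ j → g j ≢ vzero
  g-nonzero j = to (linIndep-⁅⁆ g j) (to (PG⇔g _) (from (linIndep-⁅⁆ point j) (point-nonzero j)))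

  g-distinct : ∀ {j j′} → j ≢ j′ → g j ≢ g j′
  g-distinct {j} {j′} j≢j′ = linIndep-pair⁻ g j≢j′
    (to (PG⇔g _) (linIndep-pair⁺ point j≢j′ (point-nonzero j) (point-nonzero j′) (j≢j′ ∘ point-injective)))

  sum-of-points : ∀ j j′ → PointOrZero g (g j ⊕ g j′)
  sum-of-points j j′ with j FP.≟ j′
  ... | yes refl = inj₁ (⊕-self (g j))
  ... | no j≢j′ with point-onto (point j ⊕ point j′) (j≢j′ ∘ point-injective ∘ ⊕≡vzero⇒≡)
  ...   | j″ , pj″≡ with g j″ ≟V (g j ⊕ g j′)
  ...     | yes gj″≡ = inj₂ (j″ , gj″≡)
  ...     | no gj″≢ = contradiction point-sum≡0 (linIndep-triple⁻ point j≢j′ j≢j″ j′≢j″ (from (PG⇔g _)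
              (linIndep-triple⁺ g j≢j′ j≢j″ j′≢j″ (g-nonzero j) (g-nonzero j′) (g-nonzero j″)
                 (g-distinct j≢j′) (g-distinct j≢j″) (g-distinct j′≢j″) g-sum≢0)))
    where
    j≢j″ : j ≢ j″
    j≢j″ refl = point-nonzero j′ (⊕≡ˡ⇒≡vzero (sym pj″≡))
    j′≢j″ : j′ ≢ j″
    j′≢j″ refl = point-nonzero j (⊕≡ʳ⇒≡vzero (sym pj″≡))
    g-sum≢0 : g j ⊕ (g j′ ⊕ g j″) ≢ vzero
    g-sum≢0 eq = gj″≢ (sym (⊕≡vzero⇒≡ (trans (⊕-assoc (g j) (g j′) (g j″)) eq)))
    point-sum≡0 : point j ⊕ (point j′ ⊕ point j″) ≡ vzero
    point-sum≡0 = trans (sym (⊕-assoc _ _ _)) (trans (cong (_⊕ point j″) (sym pj″≡)) (⊕-self (point j″)))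

  closed : Closed⊕ (PointOrZero g)
  closed (inj₁ refl) Pv          = subst (PointOrZero g) (sym (⊕-identityˡ _)) Pv
  closed (inj₂ Pu)   (inj₁ refl) = subst (PointOrZero g) (sym (⊕-identityʳ _)) (inj₂ Pu)
  closed (inj₂ (j , refl)) (inj₂ (j′ , refl)) = sum-of-points j j′

Spanning : ∀ {n k} → (Fin n → V k) → Set
Spanning c = ∀ v → ∃[ Z ] subsetSum c Z ≡ v

module ContractedRepresentatives {n r} {c : Fin n → V (suc r)} (simple : IsSimpleConfig c) (e : Fin n)
  (iso : SiIso (contract (LinIndep c) e) (PG r)) where
  open Contraction simple e public

  f : Fin (2 ^ r ∸ 1) → Fin n
  f = proj₁ iso

  f-nonloop : ∀ j → ¬ Loop I (f j)
  f-nonloop = proj₁ (proj₂ iso)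

  reps-distinct : ∀ j j′ → Parallel I (f j) (f j′) → j ≡ j′
  reps-distinct = proj₁ (proj₂ (proj₂ iso))

  reps-cover : ∀ x → ¬ Loop I x → ∃[ j ] Parallel I x (f j)
  reps-cover = proj₁ (proj₂ (proj₂ (proj₂ iso)))

  f-iso : ∀ Y X → IsImage f Y X → PG r Y ⇔ I X
  f-iso = proj₂ (proj₂ (proj₂ (proj₂ iso)))

  g : Fin (2 ^ r ∸ 1) → V r
  g = q ∘ c ∘ f

  f≢e : ∀ j → f j ≢ e
  f≢e j = f-nonloop j ∘ from (loop⇔≡e (f j))

  f-injective : Injective _≡_ _≡_ f
  f-injective {j} {j′} eq = reps-distinct j j′ (f-nonloop j , f-nonloop j′ , inj₁ eq)

  PG⇔g : ∀ Y → PG r Y ⇔ LinIndep g Y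
  PG⇔g Y = ⇔.trans (f-iso Y _ im)
                   (⇔.trans (contract⇔ e∉fY) (⇔.sym (linIndep-image (q ∘ c) f-injective im)))
    where
    im : IsImage f Y (image f Y)
    im = image-isImage f Y
    e∉fY : e ∉ image f Y
    e∉fY e∈ = let j , _ , fj≡e = to (im e) e∈ in f≢e j fj≡e

  q∘c-pointOrZero : ∀ x → PointOrZero g (q (c x))
  q∘c-pointOrZero x with x FP.≟ e
  ... | yes refl = inj₁ q-u
  ... | no x≢e   = let j , par = reps-cover x (x≢e ∘ to (loop⇔≡e x))
                   in inj₂ (j , sym (to (parallel⇔ x≢e (f≢e j)) par))

contraction≅PG⇒meetsLines : ∀ {n r} {c : Fin n → V (suc r)} → IsSimpleConfig c → Spanning c → ∀ e →
  SiIso (contract (LinIndep c) e) (PG r) → MeetsLinesThrough c e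
contraction≅PG⇒meetsLines {c = c} simple spanning e iso v v≢0 v≢ce = conclude (all-pointOrZero (q v))
  where
  open ContractedRepresentatives simple e iso

  -- q ∘ c spans V r, and its points lie in the subspace formed by 0 and the points of g.
  all-pointOrZero : ∀ w → PointOrZero g w
  all-pointOrZero w =
    let Z , ΣZ≡lift-w = spanning (lift w)
    in subst (PointOrZero g) (trans (subsetSum-map q-linear c Z) (trans (cong q ΣZ≡lift-w) (q-lift w)))
         (subsetSum-closed (PointOrZero g) (inj₁ refl) (pgLike⇒closed PG⇔g) (q ∘ c) q∘c-pointOrZero Z)

  conclude : PointOrZero g (q v) → IsPoint c v ⊎ IsPoint c (v ⊕ c e)
  conclude (inj₁ qv≡0) = contradiction qv≡0 (q-≢vzero v≢0 v≢ce)
  conclude (inj₂ (j , g[j]≡qv)) with q-≡ (c (f j)) v g[j]≡qv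
  ... | inj₁ c[fj]≡v   = inj₁ (f j , c[fj]≡v)
  ... | inj₂ c[fj]⊕v≡ce = inj₂ (f j , (begin
    c (f j)          ≡⟨ ⊕-cancelʳ (c (f j)) v ⟨
    c (f j) ⊕ v ⊕ v  ≡⟨ cong (_⊕ v) c[fj]⊕v≡ce ⟩
    c e ⊕ v          ≡⟨ ⊕-comm (c e) v ⟩
    v ⊕ c e          ∎))

nonPoints-closed⇒≅deletedPG : ∀ {n r} {c : Fin n → V (suc r)} → IsSimpleConfig c → Fin n →
  Closed⊕ (¬_ ∘ IsPoint c) → ∃[ m ] (m ≤ r × LinIndep c ≅ PGdel (suc r) m)
nonPoints-closed⇒≅deletedPG {n} {r} {c} simple x₀ closed =
  dim , dim≤r , ≅-respˡ {P = PGdel (suc r) dim} (linIndep-map A-linear A-kernel c)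
                   (sameImage⇒≅ A∘c-injective point-injective A∘c-point point-A∘c)
  where
  open IsSimpleConfig simple
  open StdForm (stdForm (suc r) (¬_ ∘ IsPoint c) (¬? ∘ isPoint? c) (λ (x , cx≡0) → nonzero x cx≡0) closed)
  open DeletedPG (suc r) dim dim≤K
  open IsSimpleConfig point-simple using () renaming (injective to point-injective)

  A-injective : Injective _≡_ _≡_ A
  A-injective {u} {v} Au≡Av = trans (sym (A⁻¹∘A u)) (trans (cong A⁻¹ Au≡Av) (A⁻¹∘A v))

  A-kernel : ∀ v → A v ≡ vzero → v ≡ vzero
  A-kernel v Av≡0 = A-injective (trans Av≡0 (sym (linear-vzero A-linear)))

  A∘c-injective : Injective _≡_ _≡_ (A ∘ c)
  A∘c-injective = injective ∘ A-injective

  A∘c∉flat : ∀ x → ¬ InStdFlat dim (A (c x))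
  A∘c∉flat x in-flat = from (F⇔ (c x)) in-flat (x , refl)

  A∘c-point : ∀ x → IsPoint point (A (c x))
  A∘c-point x = point-onto (A (c x)) (A∘c∉flat x)

  point-A∘c : ∀ j → IsPoint (A ∘ c) (point j)
  point-A∘c j with isPoint? c (A⁻¹ (point j))
  ... | yes (x , cx≡) = x , trans (cong A cx≡) (A∘A⁻¹ (point j))
  ... | no ¬point     =
    contradiction (subst (InStdFlat dim) (A∘A⁻¹ (point j)) (to (F⇔ _) ¬point)) (point-∉flat j)

  dim≤r : dim ≤ r
  dim≤r = ℕP.≤-pred (ℕP.≤∧≢⇒< dim≤K λ dim≡K →
    A∘c∉flat x₀ (subst (λ d → InStdFlat d (A (c x₀))) (sym dim≡K) (inStdFlat-full (A (c x₀)))))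

-- Coordinatisation

record Enumeration {n} (X : Subset n) (s : ℕ) : Set where
  field
    elem           : Fin s → Fin n
    elem-injective : Injective _≡_ _≡_ elem
    elem-image     : IsImage elem Sub.⊤ X

enumerate : ∀ {n} (X : Subset n) {s} → ∣ X ∣ ≡ s → Enumeration X s
enumerate []          {zero}  _  = record { elem = λ () ; elem-injective = λ {} ; elem-image = λ () }
enumerate {suc n} (true ∷ X) {suc s} eq = record
  { elem = elem′ ; elem-injective = injective′ ; elem-image = image′ }
  where
  open Enumeration (enumerate X (ℕP.suc-injective eq))
  elem′ : Fin (suc s) → Fin (suc n)
  elem′ fzero    = fzero
  elem′ (fsuc t) = fsuc (elem t)
  injective′ : Injective _≡_ _≡_ elem′
  injective′ {fzero}  {fzero}  _  = refl
  injective′ {fsuc i} {fsuc j} eq = cong fsuc (elem-injective (FP.suc-injective eq))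
  image′ : IsImage elem′ Sub.⊤ (true ∷ X)
  image′ fzero    = mk⇔ (λ _ → fzero , SP.∈⊤ , refl) (λ _ → here)
  image′ (fsuc x) = mk⇔
    (λ x∈ → let t , _ , et≡x = to (elem-image x) (SP.drop-there x∈) in fsuc t , SP.∈⊤ , cong fsuc et≡x)
    (λ { (fsuc t , _ , refl) → there (from (elem-image _) (t , SP.∈⊤ , refl)) })
enumerate (false ∷ X) eq = record
  { elem = fsuc ∘ elem ; elem-injective = elem-injective ∘ FP.suc-injective ; elem-image = image′ }
  where
  open Enumeration (enumerate X eq)
  image′ : IsImage (fsuc ∘ elem) Sub.⊤ (false ∷ X)
  image′ fzero    = mk⇔ (λ ()) (λ ())
  image′ (fsuc x) = mk⇔
    (λ x∈ → let t , _ , et≡x = to (elem-image x) (SP.drop-there x∈) in t , SP.∈⊤ , cong fsuc et≡x)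
    (λ { (t , _ , refl) → there (from (elem-image _) (t , SP.∈⊤ , refl)) })

module Coordinates {n k r} {φ : Fin n → V k} (φ-simple : IsSimpleConfig φ) {B : Subset n}
  (B-indep : LinIndep φ B) (∣B∣≡ : ∣ B ∣ ≡ suc r)
  (rank≤ : ∀ Y → LinIndep φ Y → ∣ Y ∣ ≤ suc r) where
  open IsSimpleConfig φ-simple
  open Enumeration (enumerate B ∣B∣≡)

  L : V (suc r) → V k
  L = subsetSum (φ ∘ elem)

  L-linear : Linear L
  L-linear = subsetSum-linear (φ ∘ elem)

  L-kernel : ∀ v → L v ≡ vzero → v ≡ vzero
  L-kernel v Lv≡0 with SP.nonempty? v
  ... | yes v≠∅ =
    contradiction Lv≡0 (from (linIndep-image φ elem-injective elem-image) B-indep v (λ _ → SP.∈⊤) v≠∅)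
  ... | no v-empty = SP.Empty-unique v-empty

  L-injective : Injective _≡_ _≡_ L
  L-injective {u} {v} Lu≡Lv =
    ⊕≡vzero⇒≡ (L-kernel _ (trans (L-linear u v) (trans (cong (L u ⊕_) (sym Lu≡Lv)) (⊕-self (L u)))))

  in-span : ∀ y → ∃[ Z ] (Z ⊆ B × subsetSum φ Z ≡ φ y)
  in-span y with y SP.∈? B
  ... | yes y∈B = ⁅ y ⁆ , (λ x∈ → subst (_∈ B) (sym (SP.x∈⁅y⁆⇒x≡y y x∈)) y∈B) , subsetSum-⁅⁆ φ y
  ... | no y∉B with linIndep-or-dependent φ (B ∪ ⁅ y ⁆)
  ...   | inj₁ indep =
    contradiction (rank≤ _ indep) (ℕP.<⇒≱ (subst (_< ∣ B ∪ ⁅ y ⁆ ∣) ∣B∣≡ (SP.p⊂q⇒∣p∣<∣q∣ B⊂B+y)))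
    where
    B⊂B+y : B ⊂ B ∪ ⁅ y ⁆
    B⊂B+y = SP.p⊆p∪q ⁅ y ⁆ , y , SP.q⊆p∪q B ⁅ y ⁆ (SP.x∈⁅x⁆ y) , y∉B
  ...   | inj₂ (W , W⊆ , W≠∅ , ΣW≡0) with y SP.∈? W
  ...     | yes y∈W = W [ y ]≔ false , []≔false-⊆ (∈∪⁅⁆-drop ∘ W⊆) , (begin
    subsetSum φ (W [ y ]≔ false) ≡⟨ ⊕≡vzero⇒≡ (trans (sym (subsetSum-split φ W y)) ΣW≡0) ⟨
    lookup W y · φ y            ≡⟨ ∈⇒· (φ y) y∈W ⟩
    φ y                         ∎)
  ...     | no y∉W = contradiction ΣW≡0 (B-indep W W⊆B W≠∅)
    where
    W⊆B : W ⊆ B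
    W⊆B x∈W = ∈∪⁅⁆-drop (W⊆ x∈W) λ { refl → y∉W x∈W }

  in-range : ∀ y → ∃[ v ] L v ≡ φ y
  in-range y =
    let Z , Z⊆B , ΣZ≡φy = in-span y
        onto = λ {x} (x∈Z : x ∈ Z) → let t , _ , et≡x = to (elem-image x) (Z⊆B x∈Z) in t , et≡x
    in preimage elem Z , trans (sym (subsetSum-image φ elem-injective (preimage-isImage onto))) ΣZ≡φy

  c : Fin n → V (suc r)
  c y = proj₁ (in-range y)

  L∘c : ∀ y → L (c y) ≡ φ y
  L∘c y = proj₂ (in-range y)

  represents : ∀ X → LinIndep φ X ⇔ LinIndep c X
  represents X = ⇔.trans (linIndep-cong (sym ∘ L∘c) X) (⇔.sym (linIndep-map L-linear L-kernel c X))

  simple : IsSimpleConfig c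
  simple = record
    { injective = λ {x} {y} cx≡cy → injective (trans (sym (L∘c x)) (trans (cong L cx≡cy) (L∘c y)))
    ; nonzero   = λ x cx≡0 → nonzero x (trans (sym (L∘c x)) (trans (cong L cx≡0) (linear-vzero L-linear)))
    }

  spanning : Spanning c
  spanning v = image elem v , (begin
    subsetSum c (image elem v) ≡⟨ subsetSum-image c elem-injective (image-isImage elem v) ⟩
    subsetSum (c ∘ elem) v     ≡⟨ subsetSum-cong c∘elem≡unit v ⟩
    subsetSum ⁅_⁆ v            ≡⟨ subsetSum-unitVectors v ⟩
    v                          ∎)
    where
    c∘elem≡unit : ∀ t → c (elem t) ≡ ⁅ t ⁆
    c∘elem≡unit t = L-injective (trans (L∘c (elem t)) (sym (subsetSum-⁅⁆ (φ ∘ elem) t)))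

simpleBinary⇒config : ∀ {r} (M : Matroid) → IsBinary M → IsSimple M → HasRank M (suc r) →
  Σ (Fin (size M) → V (suc r)) λ c → IsSimpleConfig c × Spanning c × (∀ X → Indep M X ⇔ LinIndep c X)
simpleBinary⇒config M (k , φ , M⇔φ) (indep-⁅⁆ , indep-pair) ((B , B-indep , ∣B∣≡) , rank≤) =
  c , simple , spanning , λ X → ⇔.trans (M⇔φ X) (represents X)
  where
  φ-simple : IsSimpleConfig φ
  φ-simple = record
    { injective = λ {x} {y} φx≡φy → case x FP.≟ y of λ where
        (yes x≡y) → x≡y
        (no x≢y)  → contradiction φx≡φy (linIndep-pair⁻ φ x≢y (to (M⇔φ _) (indep-pair x y x≢y)))
    ; nonzero   = λ x → to (linIndep-⁅⁆ φ x) (to (M⇔φ _) (indep-⁅⁆ x))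
    }
  open Coordinates φ-simple (to (M⇔φ B) B-indep) ∣B∣≡ (λ Y → rank≤ Y ∘ from (M⇔φ Y))

contractionsPG⇒≅deletedPG : ∀ {n r} {I : IndepPred n} {c : Fin n → V (suc r)} →
  IsSimpleConfig c → Spanning c → (∀ X → I X ⇔ LinIndep c X) → Fin n →
  (∀ e → SiIso (contract I e) (PG r)) → ∃[ m ] (m ≤ r × I ≅ PGdel (suc r) m)
contractionsPG⇒≅deletedPG {r = r} {I} {c} simple spanning I⇔c x₀ contractions =
  transport (nonPoints-closed⇒≅deletedPG simple x₀ (meetsLines⇒nonPoints-closed λ e →
    contraction≅PG⇒meetsLines simple spanning e (SiIso-cong (contract-cong I⇔c e) (contractions e))))
  where
  transport : ∃[ m ] (m ≤ r × LinIndep c ≅ PGdel (suc r) m) → ∃[ m ] (m ≤ r × I ≅ PGdel (suc r) m)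
  transport (m , m≤r , c≅) = m , m≤r , ≅-respˡ {P = PGdel (suc r) m} I⇔c c≅

≅deletedPG⇒contractionsPG : ∀ {n r m} {I : IndepPred n} → m ≤ suc r → I ≅ PGdel (suc r) m →
  ∀ e → SiIso (contract I e) (PG r)
≅deletedPG⇒contractionsPG {n} {r} {m} {I} m≤ (σ , I≅) e =
  SiIso-cong (λ X → ⇔.sym (contract-cong I⇔c e X))
    (meetsLines⇒contraction≅PG c-simple e (nonPoints-closed⇒meetsLines nonPoints-closed e))
  where
  open DeletedPG (suc r) m m≤
  open IsSimpleConfig point-simple using () renaming (injective to point-injective; nonzero to point-nonzero)
  open Inverse σ using (strictlyInverseˡ; strictlyInverseʳ)

  c : Fin n → V (suc r)
  c = point ∘ Inverse.to σ

  I⇔c : ∀ X → I X ⇔ LinIndep c X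
  I⇔c X = ⇔.trans (I≅ X) (⇔.sym (linIndep-preimage point σ X))

  c-simple : IsSimpleConfig c
  c-simple = record
    { injective = Injection.injective (Inverse⇒Injection σ) ∘ point-injective
    ; nonzero   = point-nonzero ∘ Inverse.to σ }

  nonPoint⇒inFlat : ∀ {v} → ¬ IsPoint c v → InStdFlat m v
  nonPoint⇒inFlat {v} ¬point with inStdFlat? m v
  ... | yes in-flat = in-flat
  ... | no ∉flat    = let j , pj≡v = point-onto v ∉flat in
                      contradiction (Inverse.from σ j , trans (cong point (strictlyInverseˡ j)) pj≡v) ¬point

  nonPoints-closed : Closed⊕ (¬_ ∘ IsPoint c)
  nonPoints-closed ¬u-point ¬v-point (x , cx≡u⊕v) = point-∉flat (Inverse.to σ x)
    (subst (InStdFlat m) (sym cx≡u⊕v) (inStdFlat-⊕ m (nonPoint⇒inFlat ¬u-point) (nonPoint⇒inFlat ¬v-point)))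

basis-nonempty : ∀ {r} (M : Matroid) → HasRank M (suc r) → Fin (size M)
basis-nonempty M ((B , _ , ∣B∣≡) , _) with SP.nonempty? B
... | yes (x , _) = x
... | no B-empty  =
  contradiction (trans (sym ∣B∣≡) (trans (cong ∣_∣ (SP.Empty-unique B-empty)) (SP.∣⊥∣≡0 (size M)))) λ ()

lemma3p2 : (r : ℕ) (M : Matroid) → IsBinary M → IsSimple M → HasRank M (suc r) →
    ((∀ e → SiIso (contract (Indep M) e) (PG r))
      ⇔ (∃[ i ] (i ≤ r × (Indep M ≅ PGdel (suc r) (r ∸ i)))))
lemma3p2 r M binary simple rank = mk⇔
  (λ contractions →
    let c , c-simple , spanning , M⇔c = simpleBinary⇒config M binary simple rank
        m , m≤r , M≅ = contractionsPG⇒≅deletedPG c-simple spanning M⇔c (basis-nonempty M rank) contractions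
    in r ∸ m , ℕP.m∸n≤m r m ,
       subst (λ m′ → Indep M ≅ PGdel (suc r) m′) (sym (ℕP.m∸[m∸n]≡n m≤r)) M≅)
  (λ (i , _ , M≅) → ≅deletedPG⇒contractionsPG (ℕP.m≤n⇒m≤1+n (ℕP.m∸n≤m r i)) M≅)
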